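{- Let $c\ge1$ be an integer and let $\varphi$ be the morphism on $\{A,B\}^*$ given by $\varphi(A)=A^cB$, $\varphi(B)=A$. Let $u$ be a Sturmian word with slope $\beta$ having continued fraction $\beta=[0,1,b_2,b_3,\dots]$. Let $w$ be a factor of $u$ and let $r\in\mathbb Q$, $r\ge2$, be such that $v=w^r$ is a factor of $u$. Put $w'=\varphi(w)$ and $v'=\varphi(v)A^c$. Then $v'$ is a (rational) power of $w'$ and $v'$ is a factor of a Sturmian word $u'$ with slope $\beta'=[0,1,c,b_2,b_3,\dots]$.
   Context: An infinite word $u=u_0u_1\cdots$ over $\{A,B\}$ is Sturmian if it has exactly $n+1$ distinct factors of length $n$ for every $n$. Its slope is the density $\lim_{n\to\infty}|u_0\cdots u_{n-1}|_A/n$ of the letter $A$ (an irrational number in $(0,1)$); the set of factors of a Sturmian word depends only on its slope. $[0,a_1,a_2,\dots]$ denotes the continued fraction $1/(a_1+1/(a_2+\cdots))$. A morphism $\varphi$ satisfies $\varphi(xy)=\varphi(x)\varphi(y)$. A word $v$ is a power $w^r$ of $w$, with $r=|v|/|w|$, if $|v|\ge|w|$ and $v$ is a prefix of the periodic word $www\cdots$. -}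

module Defs where

open import Data.Nat using (ℕ; zero; suc; _+_; _*_; _≤_; _<_; _≥_)
open import Data.Integer using (ℤ; +_; _-_; ∣_∣)
import Data.Integer as ℤ
open import Data.List using (List; []; _∷_; _++_; length; concat; replicate; concatMap)
open import Data.List.Relation.Unary.All using (All)
open import Data.List.Relation.Unary.Unique.Propositional using (Unique)
open import Data.List.Membership.Propositional using (_∈_)
open import Data.Product using (_×_; _,_; ∃; ∃-syntax)
open import Relation.Binary.PropositionalEquality using (_≡_)

data Letter : Set where
  A B : Letter

Word : Set
Word = List Letter

InfWord : Set
InfWord = ℕ → Letter

slice : InfWord → ℕ → ℕ → Word
slice u i zero    = []
slice u i (suc n) = u i ∷ slice u (suc i) n

Factor : Word → InfWord → Set
Factor w u = ∃[ i ] slice u i (length w) ≡ w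

Sturmian : InfWord → Set
Sturmian u = ∀ n → ∃[ L ] (length L ≡ suc n × Unique L
                           × All (λ w → length w ≡ n × Factor w u) L
                           × (∀ i → slice u i n ∈ L))

countA : InfWord → ℕ → ℕ
countA u zero = 0
countA u (suc n) with u n
... | A = suc (countA u n)
... | B = countA u n

-- Continued fraction [0, a₁, a₂, …] given by a : ℕ → ℕ with a k = a_{k+1}.
-- convergents k = ((p_k , q_k) , (p_{k-1} , q_{k-1})), p_k/q_k = [0,a₁,…,a_k]
convergents : (ℕ → ℕ) → ℕ → (ℕ × ℕ) × (ℕ × ℕ)
convergents a zero = ((0 , 1) , (1 , 0))
convergents a (suc k) with convergents a k
... | ((p , q) , (p' , q')) = ((a k * p + p' , a k * q + q') , (p , q))

numer denom : (ℕ → ℕ) → ℕ → ℕ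
numer a k with convergents a k
... | ((p , q) , _) = p
denom a k with convergents a k
... | ((p , q) , _) = q

-- The slope (density of A) of u exists and equals [0,a₁,a₂,…]:
-- for every m ≥ 1 there is N such that for all n, k ≥ N (with n ≥ 1)
--   | countA u n / n  -  p_k / q_k | < 1/m,
-- written after clearing denominators as
--   m · | countA u n · q_k − p_k · n | < n · q_k .
HasSlope : InfWord → (ℕ → ℕ) → Set
HasSlope u a = ∀ m → 1 ≤ m → ∃[ N ] ∀ n k → N ≤ n → N ≤ k → 1 ≤ n →
  m * ∣ (+ (countA u n * denom a k)) - (+ (numer a k * n)) ∣ < n * denom a k

prepend : List ℕ → (ℕ → ℕ) → ℕ → ℕ
prepend []       b k       = b k
prepend (x ∷ xs) b zero    = x
prepend (x ∷ xs) b (suc k) = prepend xs b k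

-- v is a power w^r of w (r = |v|/|w|): w nonempty, |v| ≥ |w| and v is a
-- prefix of www⋯ (equivalently of w^k for some k)
IsPower : Word → Word → Set
IsPower v w = 1 ≤ length w × length w ≤ length v
              × ∃[ k ] ∃[ t ] v ++ t ≡ concat (replicate k w)

φL : ℕ → Letter → Word
φL c A = replicate c A ++ (B ∷ [])
φL c B = A ∷ []

φ : ℕ → Word → Word
φ c = concatMap (φL c)

-- φ = θ^c ∘ E, where E exchanges A and B and θ maps A ↦ A, B ↦ AB; so u′ = θ^c(E u).
-- A word is Sturmian iff it has exactly one right special factor of each length.  E clearly
-- preserves this, and so does θ: a right special factor of θ(x) of positive length is a
-- suffix of θ(s)A for a right special factor s of x, and θ(s)A is right special in θ(x).
-- Every prefix of u′ lies between the images of two consecutive prefixes of u, which ties the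
-- frequency of A in u′ to that in u; if p/q are the convergents of [0,1,b₂,…], those of
-- [0,1,c,b₂,…] are (q + (c-1)p)/(q + cp), and the approximation errors correspond.
-- As the slope of u lies strictly between 1/2 and 1, the factors AA, AB and BA occur in u,
-- so BB does not.  Hence φ maps every factor of length two to a word beginning with A^c.
-- This extends φ(v) by A^c inside u′, and also inside φ(w)^∞: v = (w₁w₂)^q w₁ with q ≥ 2 is
-- followed in the periodic word by the square (w₂w₁)², which already occurs in v.

module Submission where

open import Defs
open import Data.Nat using (ℕ; zero; suc; _+_; _*_; _∸_; _≤_; _<_; _≤?_; _<?_; z≤n; s≤s; ∣_-_∣)
open import Data.Nat.Properties
open import Data.Nat.Tactic.RingSolver using (solve-∀)
import Data.Integer as ℤ
import Data.Integer.Properties as ℤ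
open import Data.List
  using (List; []; _∷_; _++_; _∷ʳ_; length; map; filter; concat; concatMap; replicate; take; drop; deduplicate)
open import Data.List.Properties
  using ( ≡-dec; length-++; length-map; length-take; length-drop; length-replicate; ∷-injective; ∷ʳ-injective
        ; ++-assoc; ++-identityʳ; ++-cancelˡ; concatMap-++; take++drop≡id)
open import Data.List.Relation.Unary.All using (All)
import Data.List.Relation.Unary.All as All
import Data.List.Relation.Unary.All.Properties as All
open import Data.List.Relation.Unary.AllPairs using ([]; _∷_)
open import Data.List.Relation.Unary.Any using (here; there)
open import Data.List.Relation.Unary.Unique.Propositional using (Unique)
import Data.List.Relation.Unary.Unique.Propositional.Properties as Unique
open import Data.List.Membership.Propositional using (_∈_; find; lose)
open import Data.List.Membership.Propositional.Properties
open import Data.List.Relation.Binary.Subset.Propositional using (_⊆_)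
open import Data.Product using (∃-syntax; _×_; _,_; proj₁; proj₂)
open import Data.Sum using (_⊎_; inj₁; inj₂)
open import Data.Empty using (⊥; ⊥-elim)
open import Relation.Nullary using (Dec; yes; no; ¬_)
open import Relation.Nullary.Decidable using (_×-dec_; from-yes)
open import Relation.Binary.PropositionalEquality
open import Relation.Binary.Definitions using (DecidableEquality)

_≟ᴸ_ : DecidableEquality Letter
A ≟ᴸ A = yes refl
A ≟ᴸ B = no λ ()
B ≟ᴸ A = no λ ()
B ≟ᴸ B = yes refl

_≟ᵂ_ : DecidableEquality Word
_≟ᵂ_ = ≡-dec _≟ᴸ_

open import Data.List.Membership.DecPropositional _≟ᵂ_ using (_∈?_)
open import Data.List.Relation.Unary.Unique.DecPropositional _≟ᵂ_ using (unique?)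
open import Data.List.Relation.Unary.Unique.DecPropositional.Properties _≟ᵂ_ using (deduplicate-!)

module _ {X : Set} where

  Unique⇒length≤ : {xs ys : List X} → Unique xs → xs ⊆ ys → length xs ≤ length ys
  Unique⇒length≤ {[]} _ _ = z≤n
  Unique⇒length≤ {x ∷ xs} {ys} (x∉xs ∷ uxs) xs⊆ys with ∈-∃++ (xs⊆ys (here refl))
  ... | as , bs , refl = begin
    suc (length xs)              ≤⟨ s≤s (Unique⇒length≤ uxs xs⊆as++bs) ⟩
    suc (length (as ++ bs))      ≡⟨ cong suc (length-++ as) ⟩
    suc (length as + length bs)  ≡⟨ +-suc (length as) (length bs) ⟨
    length as + suc (length bs)  ≡⟨ length-++ as ⟨
    length (as ++ x ∷ bs)        ∎
    where
    open ≤-Reasoning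
    xs⊆as++bs : xs ⊆ as ++ bs
    xs⊆as++bs z∈xs with ∈-++⁻ as (xs⊆ys (there z∈xs))
    ... | inj₁ z∈as        = ∈-++⁺ˡ z∈as
    ... | inj₂ (here refl) = ⊥-elim (All.lookup x∉xs z∈xs refl)
    ... | inj₂ (there z∈bs) = ∈-++⁺ʳ as z∈bs

  Unique-⊆-antisym⇒length≡ : {xs ys : List X} → Unique xs → Unique ys →
                             xs ⊆ ys → ys ⊆ xs → length xs ≡ length ys
  Unique-⊆-antisym⇒length≡ uxs uys xs⊆ys ys⊆xs =
    ≤-antisym (Unique⇒length≤ uxs xs⊆ys) (Unique⇒length≤ uys ys⊆xs)

  Unique-constant⇒length≡1 : {xs : List X} {s : X} → Unique xs → s ∈ xs →
                             (∀ {y} → y ∈ xs → y ≡ s) → length xs ≡ 1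
  Unique-constant⇒length≡1 {x ∷ []}    _             _ _      = refl
  Unique-constant⇒length≡1 {x ∷ y ∷ _} (x∉ ∷ _) _ all≡s =
    ⊥-elim (All.lookup x∉ (here refl) (trans (all≡s (here refl)) (sym (all≡s (there (here refl))))))

  length≡1⇒singleton : (xs : List X) → length xs ≡ 1 → ∃[ s ] xs ≡ s ∷ []
  length≡1⇒singleton (x ∷ []) _ = x , refl

  ++-injective : (as bs cs ds : List X) → as ++ bs ≡ cs ++ ds → length as ≡ length cs →
                 as ≡ cs × bs ≡ ds
  ++-injective []       bs []       ds eq _  = refl , eq
  ++-injective (a ∷ as) bs (c ∷ cs) ds eq len =
    let a≡c , tails = ∷-injective eq
        as≡cs , bs≡ds = ++-injective as bs cs ds tails (suc-injective len)
    in cong₂ _∷_ a≡c as≡cs , bs≡ds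

Suffix : Word → Word → Set
Suffix z w = ∃[ t ] t ++ z ≡ w

suffix-++ : ∀ {z w} y → Suffix z w → Suffix (z ++ y) (w ++ y)
suffix-++ {z} y (t , eq) = t , trans (sym (++-assoc t z y)) (cong (_++ y) eq)

suffix-trans : ∀ {z w v} → Suffix z w → Suffix w v → Suffix z v
suffix-trans {z} (t , eq) (t′ , eq′) = t′ ++ t , trans (++-assoc t′ t z) (trans (cong (t′ ++_) eq) eq′)

suffix-of-length : ∀ (w : Word) n → n ≤ length w → ∃[ t ] ∃[ z ] (t ++ z ≡ w × length z ≡ n)
suffix-of-length w n n≤ =
  take (length w ∸ n) w , drop (length w ∸ n) w , take++drop≡id (length w ∸ n) w ,
  trans (length-drop (length w ∸ n) w) (m∸[m∸n]≡n n≤)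

suffix-unique : ∀ {z₁ z₂ w} → Suffix z₁ w → Suffix z₂ w → length z₁ ≡ length z₂ → z₁ ≡ z₂
suffix-unique {z₁} {z₂} (t₁ , eq₁) (t₂ , eq₂) len = proj₂ (++-injective t₁ z₁ t₂ z₂ (trans eq₁ (sym eq₂)) lent)
  where
  lent : length t₁ ≡ length t₂
  lent = +-cancelʳ-≡ _ _ _ (begin
    length t₁ + length z₁ ≡⟨ length-++ t₁ ⟨
    length (t₁ ++ z₁)     ≡⟨ cong length (trans eq₁ (sym eq₂)) ⟩
    length (t₂ ++ z₂)     ≡⟨ length-++ t₂ ⟩
    length t₂ + length z₂ ≡⟨ cong (length t₂ +_) len ⟨
    length t₂ + length z₁ ∎)
    where open ≡-Reasoning

length-∷ʳ : ∀ (w : Word) a → length (w ∷ʳ a) ≡ suc (length w)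
length-∷ʳ w a = trans (length-++ w) (+-comm (length w) 1)

shift : ℕ → InfWord → InfWord
shift m x i = x (m + i)

length-slice : ∀ x i n → length (slice x i n) ≡ n
length-slice x i zero    = refl
length-slice x i (suc n) = cong suc (length-slice x (suc i) n)

slice-∷ʳ : ∀ x i n → slice x i (suc n) ≡ slice x i n ∷ʳ x (i + n)
slice-∷ʳ x i zero    = cong (λ k → x k ∷ []) (sym (+-identityʳ i))
slice-∷ʳ x i (suc n) =
  cong (x i ∷_) (trans (slice-∷ʳ x (suc i) n) (cong (λ k → slice x (suc i) n ∷ʳ x k) (sym (+-suc i n))))

slice-+ : ∀ x i m n → slice x i (m + n) ≡ slice x i m ++ slice x (i + m) n
slice-+ x i zero    n = cong (λ k → slice x k n) (sym (+-identityʳ i))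
slice-+ x i (suc m) n =
  cong (x i ∷_) (trans (slice-+ x (suc i) m n) (cong (λ k → slice x (suc i) m ++ slice x k n) (sym (+-suc i m))))

slice-cong : ∀ x y n i j → (∀ k → x (i + k) ≡ y (j + k)) → slice x i n ≡ slice y j n
slice-cong x y zero    i j eq = refl
slice-cong x y (suc n) i j eq =
  cong₂ _∷_ (trans (cong x (sym (+-identityʳ i))) (trans (eq 0) (cong y (+-identityʳ j))))
            (slice-cong x y n (suc i) (suc j)
               (λ k → trans (cong x (sym (+-suc i k))) (trans (eq (suc k)) (cong y (+-suc j k)))))

slice-shift : ∀ x m i n → slice x (m + i) n ≡ slice (shift m x) i n
slice-shift x m i n = slice-cong x (shift m x) n (m + i) i (λ k → cong x (+-assoc m i k))

take-slice : ∀ x i n m → n ≤ m → take n (slice x i m) ≡ slice x i n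
take-slice x i zero    m       _         = refl
take-slice x i (suc n) (suc m) (s≤s n≤m) = cong (x i ∷_) (take-slice x (suc i) n m n≤m)

take-drop-slice : ∀ x i n m → suc n ≤ m → take n (drop 1 (slice x i m)) ≡ slice x (suc i) n
take-drop-slice x i n (suc m) (s≤s n≤m) = take-slice x (suc i) n m n≤m

slice⇒factor : ∀ {x} i n {w} → slice x i n ≡ w → Factor w x
slice⇒factor {x} i n eq = i , trans (cong (slice x i) (trans (sym (cong length eq)) (length-slice x i n))) eq

factor-subst : ∀ {x} {w w′ : Word} → w ≡ w′ → Factor w x → Factor w′ x
factor-subst refl f = f

private
  factor-split : ∀ {x} v w → Factor (v ++ w) x → ∃[ i ] (slice x i (length v) ≡ v × slice x (i + length v) (length w) ≡ w)
  factor-split {x} v w (i , eq) = i , ++-injective _ _ v w split (length-slice x i _)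
    where
    split : slice x i (length v) ++ slice x (i + length v) (length w) ≡ v ++ w
    split = trans (sym (slice-+ x i (length v) (length w))) (trans (cong (slice x i) (sym (length-++ v))) eq)

factor-prefix : ∀ {x} v w → Factor (v ++ w) x → Factor v x
factor-prefix v w f = let i , eqv , _ = factor-split v w f in i , eqv

factor-suffix : ∀ {x} v w → Factor (v ++ w) x → Factor w x
factor-suffix v w f = let i , _ , eqw = factor-split v w f in i + length v , eqw

factor-∷ʳ⇒slice : ∀ {x} {w : Word} {a} n → length w ≡ n → Factor (w ∷ʳ a) x →
                  ∃[ i ] (slice x i n ≡ w × x (i + n) ≡ a)
factor-∷ʳ⇒slice {x} {w} {a} n len (i , eq) =
  i , ∷ʳ-injective _ _ (trans (sym (slice-∷ʳ x i n)) (trans (cong (slice x i) (sym (trans (length-∷ʳ w a) (cong suc len)))) eq))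

factor-extendʳ : ∀ {x} {w : Word} → Factor w x → ∃[ a ] Factor (w ∷ʳ a) x
factor-extendʳ {x} {w} (i , eq) =
  x (i + length w) , slice⇒factor i (suc (length w)) (trans (slice-∷ʳ x i _) (cong (_∷ʳ x (i + length w)) eq))

-- Sturmian words and right special factors

record FactorList (x : InfWord) (n : ℕ) : Set where
  field
    words    : List Word
    unique   : Unique words
    sound    : All (λ w → length w ≡ n × Factor w x) words
    complete : ∀ i → slice x i n ∈ words

  factor⇒∈ : ∀ w → length w ≡ n → Factor w x → w ∈ words
  factor⇒∈ w len (i , eq) = subst (_∈ words) (trans (cong (slice x i) (sym len)) eq) (complete i)

  ∈⇒factor : ∀ {w} → w ∈ words → length w ≡ n × Factor w x
  ∈⇒factor = All.lookup sound

  ∈⇒occurrence : ∀ {w} → w ∈ words → ∃[ i ] slice x i n ≡ w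
  ∈⇒occurrence w∈ = let len , i , eq = ∈⇒factor w∈ in i , trans (cong (slice x i) (sym len)) eq

Sturmian⇒factorList : ∀ {x} → Sturmian x → ∀ n → FactorList x n
Sturmian⇒factorList st n =
  let L , _ , uL , sL , cL = st n in record { words = L ; unique = uL ; sound = sL ; complete = cL }

length-Sturmian⇒factorList : ∀ {x} (st : Sturmian x) n →
  length (FactorList.words (Sturmian⇒factorList st n)) ≡ suc n
length-Sturmian⇒factorList st n = proj₁ (proj₂ (st n))

RightSpecial : InfWord → Word → Set
RightSpecial x w = Factor (w ∷ʳ A) x × Factor (w ∷ʳ B) x

rightSpecial-suffix : ∀ {x} t w → RightSpecial x (t ++ w) → RightSpecial x w
rightSpecial-suffix t w (fA , fB) =
  factor-suffix t (w ∷ʳ A) (factor-subst (++-assoc t w (A ∷ [])) fA) ,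
  factor-suffix t (w ∷ʳ B) (factor-subst (++-assoc t w (B ∷ [])) fB)

module RightSpecialCount {x : InfWord} {n : ℕ} (F₀ : FactorList x n) (F₁ : FactorList x (suc n)) where
  private
    module F₀ = FactorList F₀
    module F₁ = FactorList F₁

  isRightSpecial? : (w : Word) → Dec ((w ∷ʳ A) ∈ F₁.words × (w ∷ʳ B) ∈ F₁.words)
  isRightSpecial? w = ((w ∷ʳ A) ∈? F₁.words) ×-dec ((w ∷ʳ B) ∈? F₁.words)

  rightSpecials : List Word
  rightSpecials = filter isRightSpecial? F₀.words

  rightExtension : Word → Letter
  rightExtension w with (w ∷ʳ A) ∈? F₁.words
  ... | yes _ = A
  ... | no  _ = B

  rightExtension≡A : ∀ w → (w ∷ʳ A) ∈ F₁.words → rightExtension w ≡ A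
  rightExtension≡A w wA∈ with (w ∷ʳ A) ∈? F₁.words
  ... | yes _   = refl
  ... | no wA∉ = ⊥-elim (wA∉ wA∈)

  extend : Word → Word
  extend w = w ∷ʳ rightExtension w

  -- Every factor of length n+1 is listed exactly once: as the preferred extension of
  -- its prefix, or (for right special prefixes only) as the extension by B.
  extensions : List Word
  extensions = map extend F₀.words ++ map (_∷ʳ B) rightSpecials

  private
    ∷ʳ-injectiveˡ′ : ∀ {a b} {v w : Word} → v ∷ʳ a ≡ w ∷ʳ b → v ≡ w
    ∷ʳ-injectiveˡ′ {v = v} {w} eq = proj₁ (∷ʳ-injective v w eq)

  unique-extensions : Unique extensions
  unique-extensions =
    Unique.++⁺ (Unique.map⁺ ∷ʳ-injectiveˡ′ F₀.unique)
               (Unique.map⁺ ∷ʳ-injectiveˡ′ (Unique.filter⁺ isRightSpecial? F₀.unique)) disjoint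
    where
    disjoint : ∀ {v} → ¬ (v ∈ map extend F₀.words × v ∈ map (_∷ʳ B) rightSpecials)
    disjoint (p , q) with ∈-map⁻ extend p | ∈-map⁻ (_∷ʳ B) q
    ... | w₁ , _ , refl | w₂ , w₂∈ , eq with ∷ʳ-injective w₁ w₂ eq
    ... | refl , ext≡B with ∈-filter⁻ isRightSpecial? {xs = F₀.words} w₂∈
    ... | _ , (wA∈ , _) with trans (sym ext≡B) (rightExtension≡A w₁ wA∈)
    ... | ()

  extension∈ : ∀ {w i} → slice x i n ≡ w → ∀ {a} → x (i + n) ≡ a → w ∷ʳ a ∈ F₁.words
  extension∈ {w} {i} occ next = subst (_∈ F₁.words) (trans (slice-∷ʳ x i n) (cong₂ _∷ʳ_ occ next)) (F₁.complete i)

  extensions⊆factors : extensions ⊆ F₁.words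
  extensions⊆factors p with ∈-++⁻ (map extend F₀.words) p
  ... | inj₂ q with ∈-map⁻ (_∷ʳ B) q
  ... | w , w∈ , refl = proj₂ (proj₂ (∈-filter⁻ isRightSpecial? {xs = F₀.words} w∈))
  extensions⊆factors p | inj₁ q with ∈-map⁻ extend q
  ... | w , w∈ , refl = extend∈ w (F₀.∈⇒occurrence w∈)
    where
    extend∈ : ∀ w → ∃[ i ] slice x i n ≡ w → extend w ∈ F₁.words
    extend∈ w (i , occ) with (w ∷ʳ A) ∈? F₁.words | x (i + n) in next
    ... | yes wA∈ | _ = wA∈
    ... | no  wA∉ | A = ⊥-elim (wA∉ (extension∈ occ next))
    ... | no  _   | B = extension∈ occ next

  factors⊆extensions : F₁.words ⊆ extensions
  factors⊆extensions {z} z∈ with F₁.∈⇒occurrence z∈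
  ... | i , occ = subst (_∈ extensions) (trans (sym (slice-∷ʳ x i n)) occ) (listed (x (i + n)) refl)
    where
    w = slice x i n
    listed : ∀ a → x (i + n) ≡ a → w ∷ʳ a ∈ extensions
    listed a next with (w ∷ʳ A) ∈? F₁.words in dec
    listed A next | yes wA∈ =
      ∈-++⁺ˡ (subst (λ l → w ∷ʳ l ∈ map extend F₀.words) (rightExtension≡A w wA∈) (∈-map⁺ extend (F₀.complete i)))
    listed B next | yes wA∈ =
      ∈-++⁺ʳ (map extend F₀.words) (∈-map⁺ (_∷ʳ B) (∈-filter⁺ isRightSpecial? (F₀.complete i) (wA∈ , extension∈ refl next)))
    listed A next | no wA∉ = ⊥-elim (wA∉ (extension∈ refl next))
    listed B next | no wA∉ =
      ∈-++⁺ˡ (subst (λ l → w ∷ʳ l ∈ map extend F₀.words) ext≡B (∈-map⁺ extend (F₀.complete i)))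
      where
      ext≡B : rightExtension w ≡ B
      ext≡B rewrite dec = refl

  length-factors-suc : length F₁.words ≡ length F₀.words + length rightSpecials
  length-factors-suc = begin
    length F₁.words  ≡⟨ Unique-⊆-antisym⇒length≡ F₁.unique unique-extensions factors⊆extensions extensions⊆factors ⟩
    length extensions ≡⟨ length-++ (map extend F₀.words) ⟩
    length (map extend F₀.words) + length (map (_∷ʳ B) rightSpecials)
      ≡⟨ cong₂ _+_ (length-map extend F₀.words) (length-map (_∷ʳ B) rightSpecials) ⟩
    length F₀.words + length rightSpecials ∎
    where open ≡-Reasoning

  rightSpecial⇒∈ : ∀ w → length w ≡ n → RightSpecial x w → w ∈ rightSpecials
  rightSpecial⇒∈ w len (fA , fB) =
    ∈-filter⁺ isRightSpecial? (F₀.factor⇒∈ w len (factor-prefix w (A ∷ []) fA))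
      ( F₁.factor⇒∈ _ (trans (length-∷ʳ w A) (cong suc len)) fA
      , F₁.factor⇒∈ _ (trans (length-∷ʳ w B) (cong suc len)) fB)

  ∈⇒rightSpecial : ∀ {w} → w ∈ rightSpecials → length w ≡ n × RightSpecial x w
  ∈⇒rightSpecial p with ∈-filter⁻ isRightSpecial? {xs = F₀.words} p
  ... | w∈ , (wA∈ , wB∈) = proj₁ (F₀.∈⇒factor w∈) , proj₂ (F₁.∈⇒factor wA∈) , proj₂ (F₁.∈⇒factor wB∈)

UniqueRightSpecial : InfWord → ℕ → Set
UniqueRightSpecial x n =
  ∃[ s ] (length s ≡ n × RightSpecial x s × (∀ w → length w ≡ n → RightSpecial x w → w ≡ s))

Sturmian⇒uniqueRightSpecial : ∀ {x} → Sturmian x → ∀ n → UniqueRightSpecial x n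
Sturmian⇒uniqueRightSpecial {x} st n =
  s , proj₁ (∈⇒rightSpecial s∈) , proj₂ (∈⇒rightSpecial s∈) , only-s
  where
  open RightSpecialCount (Sturmian⇒factorList st n) (Sturmian⇒factorList st (suc n))
  one : length rightSpecials ≡ 1
  one = +-cancelˡ-≡ (suc n) _ _ (begin
    suc n + length rightSpecials
      ≡⟨ cong (_+ length rightSpecials) (length-Sturmian⇒factorList st n) ⟨
    length (FactorList.words (Sturmian⇒factorList st n)) + length rightSpecials
      ≡⟨ length-factors-suc ⟨
    length (FactorList.words (Sturmian⇒factorList st (suc n)))
      ≡⟨ length-Sturmian⇒factorList st (suc n) ⟩
    suc (suc n) ≡⟨ +-comm 1 (suc n) ⟩
    suc n + 1 ∎)
    where open ≡-Reasoning
  s = proj₁ (length≡1⇒singleton rightSpecials one)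
  rightSpecials≡[s] = proj₂ (length≡1⇒singleton rightSpecials one)
  s∈ : s ∈ rightSpecials
  s∈ = subst (s ∈_) (sym rightSpecials≡[s]) (here refl)
  only-s : ∀ w → length w ≡ n → RightSpecial x w → w ≡ s
  only-s w len rs with subst (w ∈_) rightSpecials≡[s] (rightSpecial⇒∈ w len rs)
  ... | here w≡s = w≡s

uniqueRightSpecial⇒Sturmian : ∀ {x} → (∀ n → FactorList x n) → (∀ n → UniqueRightSpecial x n) → Sturmian x
uniqueRightSpecial⇒Sturmian {x} F rs n =
  FactorList.words (F n) , length-factors n , FactorList.unique (F n) , FactorList.sound (F n) , FactorList.complete (F n)
  where
  length-factors : ∀ n → length (FactorList.words (F n)) ≡ suc n
  length-factors zero =
    Unique-constant⇒length≡1 (FactorList.unique (F 0)) (FactorList.complete (F 0) 0) only-[]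
    where
    only-[] : ∀ {y} → y ∈ FactorList.words (F 0) → y ≡ []
    only-[] {[]} _ = refl
    only-[] {_ ∷ _} p with FactorList.∈⇒factor (F 0) p
    ... | () , _
  length-factors (suc n) =
    trans length-factors-suc (trans (cong₂ _+_ (length-factors n) one) (+-comm (suc n) 1))
    where
    open RightSpecialCount (F n) (F (suc n))
    s = proj₁ (rs n)
    one : length rightSpecials ≡ 1
    one = Unique-constant⇒length≡1 (Unique.filter⁺ isRightSpecial? (FactorList.unique (F n)))
            (rightSpecial⇒∈ s (proj₁ (proj₂ (rs n))) (proj₁ (proj₂ (proj₂ (rs n)))))
            (λ p → proj₂ (proj₂ (proj₂ (rs n))) _ (proj₁ (∈⇒rightSpecial p)) (proj₂ (∈⇒rightSpecial p)))

swap : Letter → Letter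
swap A = B
swap B = A

map-swap-involutive : ∀ (w : Word) → map swap (map swap w) ≡ w
map-swap-involutive []      = refl
map-swap-involutive (A ∷ w) = cong (A ∷_) (map-swap-involutive w)
map-swap-involutive (B ∷ w) = cong (B ∷_) (map-swap-involutive w)

exchange : InfWord → InfWord
exchange x i = swap (x i)

slice-exchange : ∀ x i n → slice (exchange x) i n ≡ map swap (slice x i n)
slice-exchange x i zero    = refl
slice-exchange x i (suc n) = cong (swap (x i) ∷_) (slice-exchange x (suc i) n)

factor-exchange : ∀ {x} w → Factor w x → Factor (map swap w) (exchange x)
factor-exchange {x} w (i , eq) =
  i , trans (cong (slice (exchange x) i) (length-map swap w)) (trans (slice-exchange x i _) (cong (map swap) eq))

Sturmian-exchange : ∀ {x} → Sturmian x → Sturmian (exchange x)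
Sturmian-exchange {x} st n =
  let L , len , uL , sL , cL = st n in
  map (map swap) L ,
  trans (length-map _ L) len ,
  Unique.map⁺ (λ {v} {w} eq → trans (sym (map-swap-involutive v)) (trans (cong (map swap) eq) (map-swap-involutive w))) uL ,
  All.map⁺ (All.map (λ {w} (lw , fw) → trans (length-map swap w) lw , factor-exchange w fw) sL) ,
  λ i → subst (_∈ map (map swap) L) (sym (slice-exchange x i n)) (∈-map⁺ (map swap) (cL i))

-- The morphism θ : A ↦ A, B ↦ AB

θL : Letter → Word
θL A = A ∷ []
θL B = A ∷ B ∷ []

θ : Word → Word
θ = concatMap θL

θ-++ : ∀ v w → θ (v ++ w) ≡ θ v ++ θ w
θ-++ = concatMap-++ θL

length-θ : ∀ w → length w ≤ length (θ w)
length-θ []      = z≤n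
length-θ (A ∷ w) = s≤s (length-θ w)
length-θ (B ∷ w) = s≤s (m≤n⇒m≤1+n (length-θ w))

θ-∷ʳ-A : ∀ s → θ (s ∷ʳ A) ≡ θ s ∷ʳ A
θ-∷ʳ-A s = θ-++ s (A ∷ [])

θ-∷ʳ-B : ∀ s → θ (s ∷ʳ B) ≡ θ s ++ A ∷ B ∷ []
θ-∷ʳ-B s = θ-++ s (B ∷ [])

mutual
  θ∞ : InfWord → InfWord
  θ∞ x zero    = A
  θ∞ x (suc i) = θ∞-after (x 0) (shift 1 x) i

  θ∞-after : Letter → InfWord → ℕ → Letter
  θ∞-after A x i       = θ∞ x i
  θ∞-after B x zero    = B
  θ∞-after B x (suc i) = θ∞ x i

θ-start : InfWord → ℕ → ℕ
θ-start x m = length (θ (slice x 0 m))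

θ∞-shift₁ : ∀ x k → θ∞ x (length (θL (x 0)) + k) ≡ θ∞ (shift 1 x) k
θ∞-shift₁ x k with x 0 in x₀
... | A rewrite x₀ = refl
... | B rewrite x₀ = refl

θ∞-prefix₁ : ∀ x → slice (θ∞ x) 0 (length (θL (x 0))) ≡ θL (x 0)
θ∞-prefix₁ x with x 0 in x₀
... | A = refl
... | B rewrite x₀ = refl

θ-start-suc′ : ∀ x m → θ-start x (suc m) ≡ length (θL (x 0)) + θ-start (shift 1 x) m
θ-start-suc′ x m = trans (length-++ (θL (x 0))) (cong (λ w → length (θL (x 0)) + length (θ w)) (slice-shift x 1 0 m))

θ-start-suc : ∀ x m → θ-start x (suc m) ≡ θ-start x m + length (θL (x m))
θ-start-suc x m = begin
  length (θ (slice x 0 (suc m)))                  ≡⟨ cong (λ w → length (θ w)) (slice-∷ʳ x 0 m) ⟩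
  length (θ (slice x 0 m ∷ʳ x m))                 ≡⟨ cong length (θ-++ (slice x 0 m) (x m ∷ [])) ⟩
  length (θ (slice x 0 m) ++ θL (x m) ++ [])      ≡⟨ length-++ (θ (slice x 0 m)) ⟩
  θ-start x m + length (θL (x m) ++ [])           ≡⟨ cong (λ w → θ-start x m + length w) (++-identityʳ (θL (x m))) ⟩
  θ-start x m + length (θL (x m))                 ∎
  where open ≡-Reasoning

θ∞-shift : ∀ x m i → θ∞ x (θ-start x m + i) ≡ θ∞ (shift m x) i
θ∞-shift x zero    i = refl
θ∞-shift x (suc m) i = begin
  θ∞ x (θ-start x (suc m) + i)
    ≡⟨ cong (θ∞ x) (trans (cong (_+ i) (θ-start-suc′ x m)) (+-assoc (length (θL (x 0))) _ i)) ⟩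
  θ∞ x (length (θL (x 0)) + (θ-start (shift 1 x) m + i)) ≡⟨ θ∞-shift₁ x _ ⟩
  θ∞ (shift 1 x) (θ-start (shift 1 x) m + i)             ≡⟨ θ∞-shift (shift 1 x) m i ⟩
  θ∞ (shift (suc m) x) i                                  ∎
  where open ≡-Reasoning

θ∞-prefix : ∀ x m → slice (θ∞ x) 0 (θ-start x m) ≡ θ (slice x 0 m)
θ∞-prefix x zero    = refl
θ∞-prefix x (suc m) = begin
  slice (θ∞ x) 0 (θ-start x (suc m))
    ≡⟨ cong (slice (θ∞ x) 0) (θ-start-suc′ x m) ⟩
  slice (θ∞ x) 0 (ℓ + θ-start (shift 1 x) m)
    ≡⟨ slice-+ (θ∞ x) 0 ℓ (θ-start (shift 1 x) m) ⟩
  slice (θ∞ x) 0 ℓ ++ slice (θ∞ x) ℓ (θ-start (shift 1 x) m)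
    ≡⟨ cong₂ _++_ (θ∞-prefix₁ x) (slice-cong (θ∞ x) (θ∞ (shift 1 x)) _ ℓ 0 (θ∞-shift₁ x)) ⟩
  θL (x 0) ++ slice (θ∞ (shift 1 x)) 0 (θ-start (shift 1 x) m)
    ≡⟨ cong (θL (x 0) ++_) (trans (θ∞-prefix (shift 1 x) m) (cong θ (sym (slice-shift x 1 0 m)))) ⟩
  θ (slice x 0 (suc m)) ∎
  where
  open ≡-Reasoning
  ℓ = length (θL (x 0))

θ∞-slice : ∀ x j m → θ (slice x j m) ≡ slice (θ∞ x) (θ-start x j) (length (θ (slice x j m)))
θ∞-slice x j m = begin
  θ (slice x j m)                                        ≡⟨ cong θ (slice-shift′ j) ⟩
  θ (slice (shift j x) 0 m)                              ≡⟨ θ∞-prefix (shift j x) m ⟨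
  slice (θ∞ (shift j x)) 0 (θ-start (shift j x) m)
    ≡⟨ slice-cong (θ∞ x) (θ∞ (shift j x)) _ (θ-start x j) 0 (θ∞-shift x j) ⟨
  slice (θ∞ x) (θ-start x j) (θ-start (shift j x) m)
    ≡⟨ cong (λ w → slice (θ∞ x) (θ-start x j) (length (θ w))) (slice-shift′ j) ⟨
  slice (θ∞ x) (θ-start x j) (length (θ (slice x j m))) ∎
  where
  open ≡-Reasoning
  slice-shift′ : ∀ j → slice x j m ≡ slice (shift j x) 0 m
  slice-shift′ j = trans (cong (λ k → slice x k m) (sym (+-identityʳ j))) (slice-shift x j 0 m)

factor-θ : ∀ {x} w → Factor w x → Factor (θ w) (θ∞ x)
factor-θ {x} w (i , eq) =
  θ-start x i ,
  trans (cong (λ v → slice (θ∞ x) (θ-start x i) (length (θ v))) (sym eq))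
        (trans (sym (θ∞-slice x i (length w))) (cong θ eq))

θ∞-start : ∀ x j → θ∞ x (θ-start x j) ≡ A
θ∞-start x j = trans (cong (θ∞ x) (sym (+-identityʳ (θ-start x j)))) (θ∞-shift x j 0)

θ∞-start+1 : ∀ x j → x j ≡ B → θ∞ x (suc (θ-start x j)) ≡ B
θ∞-start+1 x j xj≡B =
  trans (cong (θ∞ x) (+-comm 1 (θ-start x j))) (trans (θ∞-shift x j 1) (second-letter (trans (cong x (+-identityʳ j)) xj≡B)))
  where
  second-letter : shift j x 0 ≡ B → θ∞ (shift j x) 1 ≡ B
  second-letter eq rewrite eq = refl

θ-start-suc-A : ∀ x j → x j ≡ A → θ-start x (suc j) ≡ suc (θ-start x j)
θ-start-suc-A x j eq = trans (θ-start-suc x j) (trans (cong (λ a → θ-start x j + length (θL a)) eq) (+-comm _ 1))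

θ-start-suc-B : ∀ x j → x j ≡ B → θ-start x (suc j) ≡ suc (suc (θ-start x j))
θ-start-suc-B x j eq = trans (θ-start-suc x j) (trans (cong (λ a → θ-start x j + length (θL a)) eq) (+-comm _ 2))

-- θL a ends with the letter a
θ∞-end : ∀ x j p → suc p ≡ θ-start x (suc j) → θ∞ x p ≡ x j
θ∞-end x j p eq with x j in xj
... | A = trans (cong (θ∞ x) (suc-injective (trans eq (θ-start-suc-A x j xj)))) (θ∞-start x j)
... | B = trans (cong (θ∞ x) (suc-injective (trans eq (θ-start-suc-B x j xj)))) (θ∞-start+1 x j xj)

θ∞-index-cases : ∀ x i → ∃[ j ] (i ≡ θ-start x j ⊎ (i ≡ suc (θ-start x j) × x j ≡ B))
θ∞-index-cases x zero = 0 , inj₁ refl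
θ∞-index-cases x (suc i) with θ∞-index-cases x i
... | j , inj₂ (refl , xj≡B) = suc j , inj₁ (sym (θ-start-suc-B x j xj≡B))
... | j , inj₁ refl with x j in xj
...   | A = suc j , inj₁ (sym (θ-start-suc-A x j xj))
...   | B = j , inj₂ (refl , xj)

θ∞≡B⇒after-start : ∀ x i → θ∞ x i ≡ B → ∃[ j ] (i ≡ suc (θ-start x j) × x j ≡ B)
θ∞≡B⇒after-start x i eq with θ∞-index-cases x i
... | j , inj₂ p = j , p
... | j , inj₁ refl with trans (sym (θ∞-start x j)) eq
...   | ()

θ∞≡A⇒start : ∀ x i → θ∞ x i ≡ A → ∃[ j ] i ≡ θ-start x j
θ∞≡A⇒start x i eq with θ∞-index-cases x i
... | j , inj₁ p = j , p
... | j , inj₂ (refl , xj≡B) with trans (sym (θ∞-start+1 x j xj≡B)) eq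
...   | ()

module θ∞-Sturmian (u : InfWord) (F : ∀ n → FactorList u n) (rs : ∀ n → UniqueRightSpecial u n) where

  g : InfWord
  g = θ∞ u

  -- A factor of g of length n begins at θ-start u j or one letter later, so it is a
  -- prefix of θ v or of θ v without its first letter, for the factor v of length n+1 of u at j.
  candidates : ℕ → Word → List Word
  candidates n v = take n (θ v) ∷ take n (drop 1 (θ v)) ∷ []

  candidates-slice : ∀ n j →
    take n (θ (slice u j (suc n))) ≡ slice g (θ-start u j) n ×
    take n (drop 1 (θ (slice u j (suc n)))) ≡ slice g (suc (θ-start u j)) n
  candidates-slice n j =
    trans (cong (take n) (θ∞-slice u j (suc n))) (take-slice g _ n _ (≤-trans (n≤1+n n) long)) ,
    trans (cong (λ z → take n (drop 1 z)) (θ∞-slice u j (suc n))) (take-drop-slice g _ n _ long)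
    where
    long : suc n ≤ length (θ (slice u j (suc n)))
    long = subst (_≤ length (θ (slice u j (suc n)))) (length-slice u j (suc n)) (length-θ (slice u j (suc n)))

  factorList : ∀ n → FactorList g n
  factorList n = record
    { words = deduplicate _≟ᵂ_ all-candidates
    ; unique = deduplicate-! all-candidates
    ; sound = All.tabulate (λ p → sound (find (∈-concatMap⁻ (candidates n) (∈-deduplicate⁻ _≟ᵂ_ all-candidates p))))
    ; complete = complete
    }
    where
    module F₁ = FactorList (F (suc n))
    all-candidates = concatMap (candidates n) F₁.words
    sound : ∀ {w} → ∃[ v ] (v ∈ F₁.words × w ∈ candidates n v) → length w ≡ n × Factor w g
    sound (v , v∈ , w∈) with F₁.∈⇒factor v∈
    ... | len , (j , eq) with candidates-slice n j | subst (λ l → slice u j l ≡ v) len eq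
    ... | e₁ , e₂ | refl with w∈
    ... | here refl         = trans (cong length e₁) (length-slice g _ n) , slice⇒factor (θ-start u j) n (sym e₁)
    ... | there (here refl) = trans (cong length e₂) (length-slice g _ n) , slice⇒factor (suc (θ-start u j)) n (sym e₂)
    complete : ∀ i → slice g i n ∈ deduplicate _≟ᵂ_ all-candidates
    complete i with θ∞-index-cases u i
    ... | j , inj₁ refl = ∈-deduplicate⁺ _≟ᵂ_
          (∈-concatMap⁺ (candidates n) (lose (F₁.complete j) (here (sym (proj₁ (candidates-slice n j))))))
    ... | j , inj₂ (refl , _) = ∈-deduplicate⁺ _≟ᵂ_
          (∈-concatMap⁺ (candidates n) (lose (F₁.complete j) (there (here (sym (proj₂ (candidates-slice n j)))))))

  EndsAt : Word → ℕ → Set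
  EndsAt s j = ∃[ b ] (b + length s ≡ j × slice u b (length s) ≡ s)

  endsAt-[] : ∀ j → EndsAt [] j
  endsAt-[] j = j , +-identityʳ j , refl

  endsAt-∷ʳ : ∀ {s j a} → EndsAt s j → u j ≡ a → EndsAt (s ∷ʳ a) (suc j)
  endsAt-∷ʳ {s} {j} {a} (b , end , occ) uj≡a =
    b ,
    trans (cong (b +_) (length-∷ʳ s a)) (trans (+-suc b _) (cong suc end)) ,
    trans (cong (slice u b) (length-∷ʳ s a)) (trans (slice-∷ʳ u b _) (cong₂ _∷ʳ_ occ (trans (cong u end) uj≡a)))

  endsAt⇒factor : ∀ {s j a} → EndsAt s j → u j ≡ a → Factor (s ∷ʳ a) u
  endsAt⇒factor {s} {a = a} ends uj≡a =
    let b , _ , occ = endsAt-∷ʳ ends uj≡a in b , occ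

  window-∷ʳ : ∀ {a m ℓ} → g (a + m) ≡ ℓ → slice g a (suc m) ≡ slice g a m ∷ʳ ℓ
  window-∷ʳ {a} {m} gℓ = trans (slice-∷ʳ g a m) (cong (slice g a m ∷ʳ_) gℓ)

  private
    +-suc≢0 : ∀ {a m} → a + suc m ≢ 0
    +-suc≢0 {a} {m} eq = 1+n≢0 (trans (sym (+-suc a m)) eq)

    init-last : ∀ {a a′ m} → slice g a (suc m) ≡ slice g a′ (suc m) →
                slice g a m ≡ slice g a′ m × g (a + m) ≡ g (a′ + m)
    init-last {a} {a′} {m} eq = ∷ʳ-injective _ _ (trans (sym (slice-∷ʳ g a m)) (trans eq (slice-∷ʳ g a′ m)))

    last-letter : ∀ {a m j} → a + suc m ≡ θ-start u (suc j) → g (a + m) ≡ u j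
    last-letter {a} {m} {j} e = θ∞-end u j (a + m) (trans (sym (+-suc a m)) e)

    start-A : ∀ {a m j} → a + suc m ≡ θ-start u (suc j) → u j ≡ A → a + m ≡ θ-start u j
    start-A {a} {m} {j} e uj = suc-injective (trans (trans (sym (+-suc a m)) e) (θ-start-suc-A u j uj))

    start-B : ∀ {a m j} → a + suc (suc m) ≡ θ-start u (suc j) → u j ≡ B → a + m ≡ θ-start u j
    start-B {a} {m} {j} e uj =
      suc-injective (suc-injective (trans (sym (trans (+-suc a (suc m)) (cong suc (+-suc a m)))) (trans e (θ-start-suc-B u j uj))))

  -- Equal factors of g ending at the starts of the images of u j and u J are suffixes of
  -- θ s for one word s occurring in u just before both j and J.
  CommonPreimage : ℕ → ℕ → Word → Set
  CommonPreimage j J z = ∃[ s ] (EndsAt s j × EndsAt s J × Suffix z (θ s))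

  common-preimage : ∀ m j J {a a′} → a + m ≡ θ-start u j → a′ + m ≡ θ-start u J →
                    slice g a m ≡ slice g a′ m → CommonPreimage j J (slice g a m)
  common-preimage zero    j       J       _  _  _ = [] , endsAt-[] j , endsAt-[] J , [] , refl
  common-preimage (suc m) zero    J       e  _  _ = ⊥-elim (+-suc≢0 e)
  common-preimage (suc m) (suc j) zero    _  e′ _ = ⊥-elim (+-suc≢0 e′)
  common-preimage (suc m) (suc j) (suc J) {a} {a′} e e′ eq = extend (u j) refl
    where
    uJ≡uj : u J ≡ u j
    uJ≡uj = trans (sym (last-letter e′)) (trans (sym (proj₂ (init-last eq))) (last-letter e))
    extend : ∀ ℓ → u j ≡ ℓ → CommonPreimage (suc j) (suc J) (slice g a (suc m))
    extend A uj =
      let s , ej , eJ , suf = common-preimage m j J (start-A e uj) (start-A e′ uJ) (proj₁ (init-last eq)) in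
      s ∷ʳ A , endsAt-∷ʳ ej uj , endsAt-∷ʳ eJ uJ ,
      subst₂ Suffix (sym (window-∷ʳ (trans (last-letter e) uj))) (sym (θ-∷ʳ-A s)) (suffix-++ (A ∷ []) suf)
      where uJ = trans uJ≡uj uj
    extend B uj = extend-B m e e′ eq
      where
      uJ = trans uJ≡uj uj
      -- the image θL B = AB is two letters long, so the window shrinks by two
      extend-B : ∀ m → a + suc m ≡ θ-start u (suc j) → a′ + suc m ≡ θ-start u (suc J) →
                 slice g a (suc m) ≡ slice g a′ (suc m) → CommonPreimage (suc j) (suc J) (slice g a (suc m))
      extend-B zero e e′ eq =
        B ∷ [] , endsAt-∷ʳ (endsAt-[] j) uj , endsAt-∷ʳ (endsAt-[] J) uJ ,
        A ∷ [] , cong (λ ℓ → A ∷ ℓ ∷ []) (trans (cong g (sym (+-identityʳ a))) (trans (last-letter e) uj))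
      extend-B (suc m) e e′ eq =
        let s , ej , eJ , suf = common-preimage m j J (start-B e uj) (start-B e′ uJ)
                                  (proj₁ (init-last (proj₁ (init-last eq)))) in
        s ∷ʳ B , endsAt-∷ʳ ej uj , endsAt-∷ʳ eJ uJ ,
        subst₂ Suffix (sym window) (sym (θ-∷ʳ-B s)) (suffix-++ (A ∷ B ∷ []) suf)
        where
        start = start-B e uj
        window : slice g a (suc (suc m)) ≡ slice g a m ++ A ∷ B ∷ []
        window = trans (window-∷ʳ (trans (cong g (trans (+-suc a m) (cong suc start))) (θ∞-start+1 u j uj)))
                   (trans (cong (_∷ʳ B) (window-∷ʳ (trans (cong g start) (θ∞-start u j))))
                     (++-assoc (slice g a m) (A ∷ []) (B ∷ [])))

  rightSpecial-θ∞⁻ : ∀ n w → length w ≡ suc n → RightSpecial g w →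
                     ∃[ s ] (RightSpecial u s × Suffix w (θ s ∷ʳ A))
  rightSpecial-θ∞⁻ n w len (fA , fB) with factor-∷ʳ⇒slice (suc n) len fB | factor-∷ʳ⇒slice (suc n) len fA
  ... | i , wB , gB | i′ , wA , gA with θ∞≡B⇒after-start u (i + suc n) gB | θ∞≡A⇒start u (i′ + suc n) gA
  ... | _ , e′ , _ | zero , e = ⊥-elim (1+n≢0 (trans (sym (+-suc i′ n)) e))
  ... | j , e′ , uj | suc J , e =
    let s , ej , eJ , suf = common-preimage n j J start start′ (sym (proj₁ init-last′)) in
    s , (endsAt⇒factor eJ uJ , endsAt⇒factor ej uj) ,
    subst (λ z → Suffix z (θ s ∷ʳ A)) (sym w≡) (suffix-++ (A ∷ []) suf)
    where
    start : i + n ≡ θ-start u j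
    start = suc-injective (trans (sym (+-suc i n)) e′)
    w≡ : w ≡ slice g i n ∷ʳ A
    w≡ = trans (sym wB) (window-∷ʳ (trans (cong g start) (θ∞-start u j)))
    init-last′ = ∷ʳ-injective _ _ (trans (sym (slice-∷ʳ g i′ n)) (trans wA w≡))
    uJ : u J ≡ A
    uJ = trans (sym (last-letter e)) (proj₂ init-last′)
    start′ : i′ + n ≡ θ-start u J
    start′ = start-A e uJ

  θ-∷ʳ-A-∷ʳ : ∀ s y → ∃[ r ] θ ((s ∷ʳ A) ∷ʳ y) ≡ ((θ s ∷ʳ A) ∷ʳ A) ++ r
  θ-∷ʳ-A-∷ʳ s A = [] , trans (θ-∷ʳ-A (s ∷ʳ A)) (trans (cong (_∷ʳ A) (θ-∷ʳ-A s)) (sym (++-identityʳ _)))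
  θ-∷ʳ-A-∷ʳ s B = B ∷ [] , trans (θ-∷ʳ-B (s ∷ʳ A)) (trans (cong (_++ A ∷ B ∷ []) (θ-∷ʳ-A s))
                                    (sym (++-assoc (θ s ∷ʳ A) (A ∷ []) (B ∷ []))))

  rightSpecial-θ∞⁺ : ∀ s → RightSpecial u s → RightSpecial g (θ s ∷ʳ A)
  rightSpecial-θ∞⁺ s (fA , fB) =
    factor-prefix ((θ s ∷ʳ A) ∷ʳ A) r (factor-subst θ≡ (factor-θ _ fAy)) ,
    factor-subst (trans (θ-∷ʳ-B s) (sym (++-assoc (θ s) (A ∷ []) (B ∷ [])))) (factor-θ (s ∷ʳ B) fB)
    where
    y   = proj₁ (factor-extendʳ fA)
    fAy = proj₂ (factor-extendʳ fA)
    r   = proj₁ (θ-∷ʳ-A-∷ʳ s y)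
    θ≡  = proj₂ (θ-∷ʳ-A-∷ʳ s y)

  rightSpecial-unique : ∀ {s₁ s₂} → RightSpecial u s₁ → RightSpecial u s₂ → length s₁ ≡ length s₂ → s₁ ≡ s₂
  rightSpecial-unique {s₁} {s₂} r₁ r₂ len =
    let _ , _ , _ , only = rs (length s₁) in trans (only s₁ refl r₁) (sym (only s₂ (sym len) r₂))

  rightSpecial-image-suffix : ∀ {s₁ s₂} → length s₁ ≤ length s₂ → RightSpecial u s₁ → RightSpecial u s₂ →
                              Suffix (θ s₁ ∷ʳ A) (θ s₂ ∷ʳ A)
  rightSpecial-image-suffix {s₁} {s₂} ≤len r₁ r₂ with suffix-of-length s₂ (length s₁) ≤len
  ... | t , s , refl , len with rightSpecial-unique (rightSpecial-suffix t s r₂) r₁ len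
  ... | refl = θ t , trans (cong (θ t ++_) (sym (θ-∷ʳ-A s))) (trans (sym (θ-++ t (s ∷ʳ A)))
                            (trans (cong θ (sym (++-assoc t s (A ∷ [])))) (θ-∷ʳ-A (t ++ s))))

  rightSpecial-θ∞-unique : ∀ n w w′ → length w ≡ suc n → length w′ ≡ suc n →
                           RightSpecial g w → RightSpecial g w′ → w′ ≡ w
  rightSpecial-θ∞-unique n w w′ len len′ r r′
    with rightSpecial-θ∞⁻ n w len r | rightSpecial-θ∞⁻ n w′ len′ r′
  ... | s , rs , suf | s′ , rs′ , suf′ with ≤-total (length s) (length s′)
  ... | inj₁ ≤len = suffix-unique suf′ (suffix-trans suf (rightSpecial-image-suffix ≤len rs rs′)) (trans len′ (sym len))
  ... | inj₂ ≥len = suffix-unique (suffix-trans suf′ (rightSpecial-image-suffix ≥len rs′ rs)) suf (trans len′ (sym len))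

  rightSpecial-θ∞-exists : ∀ n → ∃[ w ] (length w ≡ n × RightSpecial g w)
  rightSpecial-θ∞-exists n with rs n
  ... | s , refl , r , _ with suffix-of-length (θ s ∷ʳ A) (length s) long
    where
    long : length s ≤ length (θ s ∷ʳ A)
    long = ≤-trans (length-θ s) (≤-trans (n≤1+n _) (≤-reflexive (sym (length-∷ʳ (θ s) A))))
  ... | t , w , eq , len = w , len , rightSpecial-suffix t w (subst (RightSpecial g) (sym eq) (rightSpecial-θ∞⁺ s r))

  uniqueRightSpecial : ∀ n → UniqueRightSpecial g n
  uniqueRightSpecial n =
    let w , len , r = rightSpecial-θ∞-exists n in w , len , r , only n w len r
    where
    only : ∀ n w → length w ≡ n → RightSpecial g w → ∀ w′ → length w′ ≡ n → RightSpecial g w′ → w′ ≡ w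
    only zero    [] _   _ [] _    _  = refl
    only (suc n) w  len r w′ len′ r′ = rightSpecial-θ∞-unique n w w′ len len′ r r′

Sturmian-θ∞ : ∀ {x} → Sturmian x → Sturmian (θ∞ x)
Sturmian-θ∞ {x} st = uniqueRightSpecial⇒Sturmian factorList uniqueRightSpecial
  where open θ∞-Sturmian x (Sturmian⇒factorList st) (Sturmian⇒uniqueRightSpecial st)

-- φ = θ^c ∘ exchange

θ^ : ℕ → Word → Word
θ^ zero    w = w
θ^ (suc c) w = θ (θ^ c w)

θ∞^ : ℕ → InfWord → InfWord
θ∞^ zero    x = x
θ∞^ (suc c) x = θ∞ (θ∞^ c x)

θ^-++ : ∀ c v w → θ^ c (v ++ w) ≡ θ^ c v ++ θ^ c w
θ^-++ zero    v w = refl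
θ^-++ (suc c) v w = trans (cong θ (θ^-++ c v w)) (θ-++ (θ^ c v) (θ^ c w))

θ^-[] : ∀ c → θ^ c [] ≡ []
θ^-[] zero    = refl
θ^-[] (suc c) = cong θ (θ^-[] c)

θ^-A : ∀ c → θ^ c (A ∷ []) ≡ A ∷ []
θ^-A zero    = refl
θ^-A (suc c) = cong θ (θ^-A c)

θ-replicate-A : ∀ c → θ (replicate c A) ≡ replicate c A
θ-replicate-A zero    = refl
θ-replicate-A (suc c) = cong (A ∷_) (θ-replicate-A c)

replicate-++-∷ : ∀ {X : Set} c (x : X) r → replicate c x ++ x ∷ r ≡ x ∷ replicate c x ++ r
replicate-++-∷ zero    x r = refl
replicate-++-∷ (suc c) x r = cong (x ∷_) (replicate-++-∷ c x r)

θ^-B : ∀ c → θ^ c (B ∷ []) ≡ replicate c A ++ B ∷ []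
θ^-B zero    = refl
θ^-B (suc c) = begin
  θ (θ^ c (B ∷ []))               ≡⟨ cong θ (θ^-B c) ⟩
  θ (replicate c A ++ B ∷ [])     ≡⟨ θ-++ (replicate c A) (B ∷ []) ⟩
  θ (replicate c A) ++ A ∷ B ∷ [] ≡⟨ cong (_++ A ∷ B ∷ []) (θ-replicate-A c) ⟩
  replicate c A ++ A ∷ B ∷ []     ≡⟨ replicate-++-∷ c A (B ∷ []) ⟩
  replicate (suc c) A ++ B ∷ []   ∎
  where open ≡-Reasoning

φ-++ : ∀ c v w → φ c (v ++ w) ≡ φ c v ++ φ c w
φ-++ c = concatMap-++ (φL c)

-- φ(A) = A^c B = θ^c(B) and φ(B) = A = θ^c(A)
φ≡θ^∘swap : ∀ c w → φ c w ≡ θ^ c (map swap w)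
φ≡θ^∘swap c []      = sym (θ^-[] c)
φ≡θ^∘swap c (a ∷ w) =
  trans (cong₂ _++_ (letter a) (φ≡θ^∘swap c w)) (sym (θ^-++ c (swap a ∷ []) (map swap w)))
  where
  letter : ∀ a → φL c a ≡ θ^ c (swap a ∷ [])
  letter A = sym (θ^-B c)
  letter B = sym (θ^-A c)

Sturmian-θ∞^ : ∀ c {x} → Sturmian x → Sturmian (θ∞^ c x)
Sturmian-θ∞^ zero    st = st
Sturmian-θ∞^ (suc c) st = Sturmian-θ∞ (Sturmian-θ∞^ c st)

factor-θ^ : ∀ c {x} w → Factor w x → Factor (θ^ c w) (θ∞^ c x)
factor-θ^ zero    w f = f
factor-θ^ (suc c) w f = factor-θ (θ^ c w) (factor-θ^ c w f)

θ∞^-prefix : ∀ c x ℓ → slice (θ∞^ c x) 0 (length (θ^ c (slice x 0 ℓ))) ≡ θ^ c (slice x 0 ℓ)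
θ∞^-prefix zero    x ℓ = cong (slice x 0) (length-slice x 0 ℓ)
θ∞^-prefix (suc c) x ℓ = begin
  slice (θ∞ (θ∞^ c x)) 0 (length (θ (θ^ c (slice x 0 ℓ))))
    ≡⟨ cong (λ w → slice (θ∞ (θ∞^ c x)) 0 (length (θ w))) (θ∞^-prefix c x ℓ) ⟨
  slice (θ∞ (θ∞^ c x)) 0 (θ-start (θ∞^ c x) (length (θ^ c (slice x 0 ℓ))))
    ≡⟨ θ∞-prefix (θ∞^ c x) (length (θ^ c (slice x 0 ℓ))) ⟩
  θ (slice (θ∞^ c x) 0 (length (θ^ c (slice x 0 ℓ))))
    ≡⟨ cong θ (θ∞^-prefix c x ℓ) ⟩
  θ (θ^ c (slice x 0 ℓ)) ∎
  where open ≡-Reasoning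

φ∞ : ℕ → InfWord → InfWord
φ∞ c x = θ∞^ c (exchange x)

Sturmian-φ∞ : ∀ c {x} → Sturmian x → Sturmian (φ∞ c x)
Sturmian-φ∞ c st = Sturmian-θ∞^ c (Sturmian-exchange st)

factor-φ∞ : ∀ c {x} w → Factor w x → Factor (φ c w) (φ∞ c x)
factor-φ∞ c w f = factor-subst (sym (φ≡θ^∘swap c w)) (factor-θ^ c (map swap w) (factor-exchange w f))

φ-start : ℕ → InfWord → ℕ → ℕ
φ-start c x n = length (φ c (slice x 0 n))

φ∞-prefix : ∀ c x n → slice (φ∞ c x) 0 (φ-start c x n) ≡ φ c (slice x 0 n)
φ∞-prefix c x n = begin
  slice (φ∞ c x) 0 (φ-start c x n)                              ≡⟨ cong (λ w → slice (φ∞ c x) 0 (length w)) φ≡ ⟩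
  slice (φ∞ c x) 0 (length (θ^ c (slice (exchange x) 0 n)))     ≡⟨ θ∞^-prefix c (exchange x) n ⟩
  θ^ c (slice (exchange x) 0 n)                                 ≡⟨ φ≡ ⟨
  φ c (slice x 0 n)                                             ∎
  where
  open ≡-Reasoning
  φ≡ : φ c (slice x 0 n) ≡ θ^ c (slice (exchange x) 0 n)
  φ≡ = trans (φ≡θ^∘swap c _) (cong (θ^ c) (sym (slice-exchange x 0 n)))

φ-start-suc : ∀ c x n → φ-start c x (suc n) ≡ φ-start c x n + length (φL c (x n))
φ-start-suc c x n = begin
  length (φ c (slice x 0 (suc n)))               ≡⟨ cong (λ w → length (φ c w)) (slice-∷ʳ x 0 n) ⟩
  length (φ c (slice x 0 n ∷ʳ x n))              ≡⟨ cong length (φ-++ c (slice x 0 n) (x n ∷ [])) ⟩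
  length (φ c (slice x 0 n) ++ φL c (x n) ++ []) ≡⟨ length-++ (φ c (slice x 0 n)) ⟩
  φ-start c x n + length (φL c (x n) ++ [])      ≡⟨ cong (λ w → φ-start c x n + length w) (++-identityʳ (φL c (x n))) ⟩
  φ-start c x n + length (φL c (x n))            ∎
  where open ≡-Reasoning

φ∞-block : ∀ c x n → slice (φ∞ c x) (φ-start c x n) (length (φL c (x n))) ≡ φL c (x n)
φ∞-block c x n = ++-cancelˡ (φ c (slice x 0 n)) _ _ (begin
  φ c (slice x 0 n) ++ slice (φ∞ c x) (φ-start c x n) ℓ
    ≡⟨ cong (_++ slice (φ∞ c x) (φ-start c x n) ℓ) (φ∞-prefix c x n) ⟨
  slice (φ∞ c x) 0 (φ-start c x n) ++ slice (φ∞ c x) (φ-start c x n) ℓ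
    ≡⟨ slice-+ (φ∞ c x) 0 (φ-start c x n) ℓ ⟨
  slice (φ∞ c x) 0 (φ-start c x n + ℓ)
    ≡⟨ cong (slice (φ∞ c x) 0) (φ-start-suc c x n) ⟨
  slice (φ∞ c x) 0 (φ-start c x (suc n))
    ≡⟨ φ∞-prefix c x (suc n) ⟩
  φ c (slice x 0 (suc n))
    ≡⟨ trans (cong (φ c) (slice-∷ʳ x 0 n)) (trans (φ-++ c (slice x 0 n) (x n ∷ [])) (cong (φ c (slice x 0 n) ++_) (++-identityʳ _))) ⟩
  φ c (slice x 0 n) ++ φL c (x n) ∎)
  where
  open ≡-Reasoning
  ℓ = length (φL c (x n))

φ∞-prefix-within-block : ∀ c x n r → r ≤ length (φL c (x n)) →
  slice (φ∞ c x) 0 (φ-start c x n + r) ≡ φ c (slice x 0 n) ++ take r (φL c (x n))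
φ∞-prefix-within-block c x n r r≤ = begin
  slice (φ∞ c x) 0 (φ-start c x n + r)
    ≡⟨ slice-+ (φ∞ c x) 0 (φ-start c x n) r ⟩
  slice (φ∞ c x) 0 (φ-start c x n) ++ slice (φ∞ c x) (φ-start c x n) r
    ≡⟨ cong₂ _++_ (φ∞-prefix c x n) (sym (take-slice (φ∞ c x) _ r _ r≤)) ⟩
  φ c (slice x 0 n) ++ take r (slice (φ∞ c x) (φ-start c x n) (length (φL c (x n))))
    ≡⟨ cong (λ w → φ c (slice x 0 n) ++ take r w) (φ∞-block c x n) ⟩
  φ c (slice x 0 n) ++ take r (φL c (x n)) ∎
  where open ≡-Reasoning

length-φL-A : ∀ c → length (φL c A) ≡ suc c
length-φL-A c = trans (length-++ (replicate c A)) (trans (cong (_+ 1) (length-replicate c)) (+-comm c 1))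

1≤length-φL : ∀ c a → 1 ≤ length (φL c a)
1≤length-φL c A = subst (1 ≤_) (sym (length-φL-A c)) (s≤s z≤n)
1≤length-φL c B = s≤s z≤n

length-φL≤ : ∀ c a → length (φL c a) ≤ suc c
length-φL≤ c A = ≤-reflexive (length-φL-A c)
length-φL≤ c B = s≤s z≤n

φ-start-decomposition : ∀ c x n′ → ∃[ n ] ∃[ r ] (n′ ≡ φ-start c x n + r × r < length (φL c (x n)))
φ-start-decomposition c x zero = 0 , 0 , refl , 1≤length-φL c (x 0)
φ-start-decomposition c x (suc n′) with φ-start-decomposition c x n′
... | n , r , n′≡ , r< with suc r <? length (φL c (x n))
...   | yes r+1< = n , suc r , trans (cong suc n′≡) (sym (+-suc _ r)) , r+1<
...   | no  r+1≮ = suc n , 0 , next-block , 1≤length-φL c (x (suc n))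
  where
  next-block : suc n′ ≡ φ-start c x (suc n) + 0
  next-block = begin
    suc n′                                  ≡⟨ cong suc n′≡ ⟩
    suc (φ-start c x n + r)                 ≡⟨ +-suc _ r ⟨
    φ-start c x n + suc r                   ≡⟨ cong (φ-start c x n +_) (≤-antisym r< (≮⇒≥ r+1≮)) ⟩
    φ-start c x n + length (φL c (x n))     ≡⟨ φ-start-suc c x n ⟨
    φ-start c x (suc n)                     ≡⟨ +-identityʳ _ ⟨
    φ-start c x (suc n) + 0                 ∎
    where open ≡-Reasoning

-- Letter frequencies and the slope of φ∞ c x

#A : Word → ℕ
#A []      = 0
#A (A ∷ w) = suc (#A w)
#A (B ∷ w) = #A w

#A-++ : ∀ v w → #A (v ++ w) ≡ #A v + #A w
#A-++ []      w = refl
#A-++ (A ∷ v) w = cong suc (#A-++ v w)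
#A-++ (B ∷ v) w = #A-++ v w

#A≤length : ∀ w → #A w ≤ length w
#A≤length []      = z≤n
#A≤length (A ∷ w) = s≤s (#A≤length w)
#A≤length (B ∷ w) = m≤n⇒m≤1+n (#A≤length w)

#A-replicate-A : ∀ c → #A (replicate c A) ≡ c
#A-replicate-A zero    = refl
#A-replicate-A (suc c) = cong suc (#A-replicate-A c)

countA-suc : ∀ x n → countA x (suc n) ≡ countA x n + #A (x n ∷ [])
countA-suc x n with x n
... | A = +-comm 1 (countA x n)
... | B = sym (+-identityʳ _)

countA≡#A-slice : ∀ x n → countA x n ≡ #A (slice x 0 n)
countA≡#A-slice x zero    = refl
countA≡#A-slice x (suc n) = begin
  countA x (suc n)                  ≡⟨ countA-suc x n ⟩
  countA x n + #A (x n ∷ [])        ≡⟨ cong (_+ #A (x n ∷ [])) (countA≡#A-slice x n) ⟩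
  #A (slice x 0 n) + #A (x n ∷ [])  ≡⟨ #A-++ (slice x 0 n) (x n ∷ []) ⟨
  #A (slice x 0 n ∷ʳ x n)          ≡⟨ cong #A (slice-∷ʳ x 0 n) ⟨
  #A (slice x 0 (suc n))            ∎
  where open ≡-Reasoning

countA≤ : ∀ x n → countA x n ≤ n
countA≤ x n = subst₂ _≤_ (sym (countA≡#A-slice x n)) (length-slice x 0 n) (#A≤length (slice x 0 n))

#A-φL-A : ∀ c → #A (φL c A) ≡ c
#A-φL-A c = trans (#A-++ (replicate c A) (B ∷ [])) (trans (+-identityʳ _) (#A-replicate-A c))

-- each A of w contributes c₀ + 1 letters A to φ (c₀ + 1) w, and each B one
#A-φ : ∀ c₀ w → #A (φ (suc c₀) w) ≡ length w + c₀ * #A w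
#A-φ c₀ []      = sym (*-zeroʳ c₀)
#A-φ c₀ (A ∷ w) =
  trans (#A-++ (φL (suc c₀) A) (φ (suc c₀) w))
        (trans (cong₂ _+_ (#A-φL-A (suc c₀)) (#A-φ c₀ w)) (alg c₀ (length w) (#A w)))
  where
  alg : ∀ c₀ ℓ a → suc c₀ + (ℓ + c₀ * a) ≡ suc ℓ + c₀ * suc a
  alg = solve-∀
#A-φ c₀ (B ∷ w) = cong suc (#A-φ c₀ w)

length-φ : ∀ c w → length (φ c w) ≡ length w + c * #A w
length-φ c []      = sym (*-zeroʳ c)
length-φ c (A ∷ w) =
  trans (length-++ (φL c A)) (trans (cong₂ _+_ (length-φL-A c) (length-φ c w)) (alg c (length w) (#A w)))
  where
  alg : ∀ c ℓ a → suc c + (ℓ + c * a) ≡ suc ℓ + c * suc a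
  alg = solve-∀
length-φ c (B ∷ w) = cong suc (length-φ c w)

φ-start≡ : ∀ c x n → φ-start c x n ≡ n + c * countA x n
φ-start≡ c x n =
  trans (length-φ c (slice x 0 n)) (cong₂ (λ ℓ a → ℓ + c * a) (length-slice x 0 n) (sym (countA≡#A-slice x n)))

countA-φ∞ : ∀ c₀ x n r → r ≤ length (φL (suc c₀) (x n)) →
  countA (φ∞ (suc c₀) x) (φ-start (suc c₀) x n + r) ≡ (n + c₀ * countA x n) + #A (take r (φL (suc c₀) (x n)))
countA-φ∞ c₀ x n r r≤ = begin
  countA (φ∞ c x) (φ-start c x n + r)                         ≡⟨ countA≡#A-slice (φ∞ c x) (φ-start c x n + r) ⟩
  #A (slice (φ∞ c x) 0 (φ-start c x n + r))                   ≡⟨ cong #A (φ∞-prefix-within-block c x n r r≤) ⟩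
  #A (φ c (slice x 0 n) ++ take r (φL c (x n)))               ≡⟨ #A-++ (φ c (slice x 0 n)) _ ⟩
  #A (φ c (slice x 0 n)) + #A (take r (φL c (x n)))           ≡⟨ cong (_+ #A (take r (φL c (x n)))) (#A-φ c₀ (slice x 0 n)) ⟩
  (length (slice x 0 n) + c₀ * #A (slice x 0 n)) + #A (take r (φL c (x n)))
    ≡⟨ cong₂ (λ ℓ a → (ℓ + c₀ * a) + #A (take r (φL c (x n)))) (length-slice x 0 n) (sym (countA≡#A-slice x n)) ⟩
  (n + c₀ * countA x n) + #A (take r (φL c (x n)))           ∎
  where
  open ≡-Reasoning
  c = suc c₀

∣+m-+n∣≡∣m-n∣ : ∀ m n → ℤ.∣ ℤ.+ m ℤ.- ℤ.+ n ∣ ≡ ∣ m - n ∣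
∣+m-+n∣≡∣m-n∣ m n with ≤-total m n
... | inj₁ m≤n = trans (cong ℤ.∣_∣ (ℤ.m-n≡m⊖n m n)) (trans (ℤ.∣⊖∣-≤ m≤n) (sym (m≤n⇒∣m-n∣≡n∸m m≤n)))
... | inj₂ n≤m = trans (cong ℤ.∣_∣ (ℤ.m-n≡m⊖n m n))
                   (trans (ℤ.∣m⊖n∣≡∣n⊖m∣ m n) (trans (ℤ.∣⊖∣-≤ n≤m) (sym (m≤n⇒∣n-m∣≡n∸m n≤m))))

∣-∣-cross : ∀ x y z w → x + w ≡ y + z → ∣ x - y ∣ ≡ ∣ z - w ∣
∣-∣-cross x y z w eq = begin
  ∣ x - y ∣             ≡⟨ ∣m+n-m+o∣≡∣n-o∣ w x y ⟨
  ∣ w + x - w + y ∣     ≡⟨ cong₂ ∣_-_∣ (trans (+-comm w x) eq) (+-comm w y) ⟩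
  ∣ y + z - y + w ∣     ≡⟨ ∣m+n-m+o∣≡∣n-o∣ y z w ⟩
  ∣ z - w ∣             ∎
  where open ≡-Reasoning

∣-∣-+-≤ : ∀ x₁ x₂ y₁ y₂ → ∣ x₁ + x₂ - y₁ + y₂ ∣ ≤ ∣ x₁ - y₁ ∣ + ∣ x₂ - y₂ ∣
∣-∣-+-≤ x₁ x₂ y₁ y₂ = ≤-trans (∣-∣-triangle (x₁ + x₂) (y₁ + x₂) (y₁ + y₂))
  (+-mono-≤ (≤-reflexive (trans (cong₂ ∣_-_∣ (+-comm x₁ x₂) (+-comm y₁ x₂)) (∣m+n-m+o∣≡∣n-o∣ x₂ x₁ y₁)))
            (≤-reflexive (∣m+n-m+o∣≡∣n-o∣ y₁ x₂ y₂)))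

∣-∣≤ : ∀ {x y b} → x ≤ b → y ≤ b → ∣ x - y ∣ ≤ b
∣-∣≤ {x} {y} x≤b y≤b = ≤-trans (∣m-n∣≤m⊔n x y) (⊔-lub x≤b y≤b)

numer-recurrence : ∀ a k → numer a (suc (suc k)) ≡ a (suc k) * numer a (suc k) + numer a k
numer-recurrence a k with convergents a k
... | (p , q) , (p′ , q′) = refl

denom-recurrence : ∀ a k → denom a (suc (suc k)) ≡ a (suc k) * denom a (suc k) + denom a k
denom-recurrence a k with convergents a k
... | (p , q) , (p′ , q′) = refl

convergents-insert : ∀ c₀ b k →
  let a = prepend (1 ∷ []) b ; a′ = prepend (1 ∷ suc c₀ ∷ []) b in
  numer a′ (suc k) ≡ denom a k + c₀ * numer a k × denom a′ (suc k) ≡ denom a k + suc c₀ * numer a k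
convergents-insert c₀ b k = proj₁ (two-steps k)
  where
  a = prepend (1 ∷ []) b
  a′ = prepend (1 ∷ suc c₀ ∷ []) b
  Insert : ℕ → Set
  Insert k = numer a′ (suc k) ≡ denom a k + c₀ * numer a k × denom a′ (suc k) ≡ denom a k + suc c₀ * numer a k
  step : ∀ k → Insert k → Insert (suc k) → Insert (suc (suc k))
  step k (p₀ , q₀) (p₁ , q₁) =
    trans (numer-recurrence a′ (suc k)) (trans (cong₂ (λ x y → b k * x + y) p₁ p₀)
      (trans (alg (b k) _ _ _ _ c₀) (sym (cong₂ (λ x y → x + c₀ * y) (denom-recurrence a k) (numer-recurrence a k))))) ,
    trans (denom-recurrence a′ (suc k)) (trans (cong₂ (λ x y → b k * x + y) q₁ q₀)
      (trans (alg (b k) _ _ _ _ (suc c₀)) (sym (cong₂ (λ x y → x + suc c₀ * y) (denom-recurrence a k) (numer-recurrence a k)))))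
    where
    alg : ∀ β x y x′ y′ c → β * (x + c * y) + (x′ + c * y′) ≡ (β * x + x′) + c * (β * y + y′)
    alg = solve-∀
  two-steps : ∀ k → Insert k × Insert (suc k)
  two-steps zero    = (alg₀ c₀ , alg₁ c₀) , (alg₂ c₀ , alg₃ c₀)
    where
    alg₀ : ∀ c₀ → 1 ≡ 1 + c₀ * 0
    alg₀ = solve-∀
    alg₁ : ∀ c₀ → 1 ≡ 1 + suc c₀ * 0
    alg₁ = solve-∀
    alg₂ : ∀ c₀ → suc c₀ * 1 + 0 ≡ 1 + c₀ * 1
    alg₂ = solve-∀
    alg₃ : ∀ c₀ → suc c₀ * 1 + 1 ≡ 1 + suc c₀ * 1
    alg₃ = solve-∀
  two-steps (suc k) = let i₀ , i₁ = two-steps k in i₁ , step k i₀ i₁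

module _ (c₀ n a p q : ℕ) where
  private
    c  = suc c₀
    p′ = q + c₀ * p
    q′ = q + c * p

  φ-error-main : ∣ (n + c₀ * a) * q′ - p′ * (n + c * a) ∣ ≡ ∣ a * q - p * n ∣
  φ-error-main = trans (∣-∣-cross _ _ (p * n) (a * q) (alg c₀ n a p q)) (∣-∣-comm (p * n) (a * q))
    where
    alg : ∀ c₀ n a p q → (n + c₀ * a) * (q + suc c₀ * p) + a * q ≡ (q + c₀ * p) * (n + suc c₀ * a) + p * n
    alg = solve-∀

  φ-error-bound : ∀ e r → e ≤ r → r ≤ c →
    ∣ (n + c₀ * a + e) * q′ - p′ * (n + c * a + r) ∣ ≤ ∣ a * q - p * n ∣ + c * q′
  φ-error-bound e r e≤r r≤c = begin
    ∣ (n + c₀ * a + e) * q′ - p′ * (n + c * a + r) ∣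
      ≡⟨ cong₂ ∣_-_∣ (*-distribʳ-+ q′ (n + c₀ * a) e) (*-distribˡ-+ p′ (n + c * a) r) ⟩
    ∣ (n + c₀ * a) * q′ + e * q′ - p′ * (n + c * a) + p′ * r ∣
      ≤⟨ ∣-∣-+-≤ ((n + c₀ * a) * q′) (e * q′) (p′ * (n + c * a)) (p′ * r) ⟩
    ∣ (n + c₀ * a) * q′ - p′ * (n + c * a) ∣ + ∣ e * q′ - p′ * r ∣
      ≤⟨ +-mono-≤ (≤-reflexive φ-error-main)
           (∣-∣≤ (*-monoˡ-≤ q′ (≤-trans e≤r r≤c)) (≤-trans (*-mono-≤ p′≤q′ r≤c) (≤-reflexive (*-comm q′ c)))) ⟩
    ∣ a * q - p * n ∣ + c * q′ ∎
    where
    open ≤-Reasoning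
    p′≤q′ : p′ ≤ q′
    p′≤q′ = +-monoʳ-≤ q (*-monoˡ-≤ p (n≤1+n c₀))

  φ-error : ∀ m e r n′ → n′ ≡ n + c * a + r → e ≤ r → r ≤ c → 2 * m * c ≤ n′ →
    2 * m * ∣ a * q - p * n ∣ < n * q →
    m * ∣ (n + c₀ * a + e) * q′ - p′ * n′ ∣ < n′ * q′
  φ-error m e r n′ refl e≤r r≤c large approx = *-cancelˡ-< 2 _ _ (begin-strict
    2 * (m * ∣ (n + c₀ * a + e) * q′ - p′ * n′ ∣)
      ≤⟨ *-monoʳ-≤ 2 (*-monoʳ-≤ m (φ-error-bound e r e≤r r≤c)) ⟩
    2 * (m * (∣ a * q - p * n ∣ + c * q′))  ≡⟨ alg₁ m ∣ a * q - p * n ∣ c q′ ⟩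
    2 * m * ∣ a * q - p * n ∣ + (2 * m * c) * q′
      <⟨ +-monoˡ-< _ approx ⟩
    n * q + (2 * m * c) * q′
      ≤⟨ +-mono-≤ (*-mono-≤ n≤n′ (m≤m+n q (c * p))) (*-monoˡ-≤ q′ large) ⟩
    n′ * q′ + n′ * q′                        ≡⟨ alg₂ (n′ * q′) ⟩
    2 * (n′ * q′) ∎)
    where
    open ≤-Reasoning
    n≤n′ : n ≤ n′
    n≤n′ = ≤-trans (m≤m+n n (c * a)) (m≤m+n _ r)
    alg₁ : ∀ m D c q′ → 2 * (m * (D + c * q′)) ≡ 2 * m * D + (2 * m * c) * q′
    alg₁ = solve-∀
    alg₂ : ∀ x → x + x ≡ 2 * x
    alg₂ = solve-∀

φ-start-bound : ∀ c n a r → a ≤ n → r ≤ c → n + c * a + r < suc c * suc n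
φ-start-bound c n a r a≤n r≤c = begin-strict
  n + c * a + r   ≤⟨ +-mono-≤ (+-monoʳ-≤ n (*-monoʳ-≤ c a≤n)) r≤c ⟩
  n + c * n + c   <⟨ s≤s (≤-reflexive (alg c n)) ⟩
  suc c * suc n   ∎
  where
  open ≤-Reasoning
  alg : ∀ c n → n + c * n + c ≡ n + c * suc n
  alg = solve-∀

HasSlope-φ∞ : ∀ c₀ b x → HasSlope x (prepend (1 ∷ []) b) → HasSlope (φ∞ (suc c₀) x) (prepend (1 ∷ suc c₀ ∷ []) b)
HasSlope-φ∞ c₀ b x slope m 1≤m = N′ , bound
  where
  a  = prepend (1 ∷ []) b
  a′ = prepend (1 ∷ suc c₀ ∷ []) b
  c  = suc c₀
  approximation = slope (2 * m) (≤-trans 1≤m (m≤m+n m (m + 0)))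
  N  = proj₁ approximation
  T  = suc c * suc N + 2 * m * c
  N′ = suc N + T
  bound : ∀ n′ k′ → N′ ≤ n′ → N′ ≤ k′ → 1 ≤ n′ →
          m * ℤ.∣ ℤ.+ (countA (φ∞ c x) n′ * denom a′ k′) ℤ.- ℤ.+ (numer a′ k′ * n′) ∣ < n′ * denom a′ k′
  bound n′ (suc k) N′≤n′ (s≤s N+T≤k) _ with φ-start-decomposition c x n′
  ... | n , r , n′≡ , r< =
    subst₂ (λ l r → m * l < r) (sym error≡) (cong (n′ *_) (sym q′≡))
      (φ-error c₀ n α p q m e r n′ n′≡′ e≤r r≤c 2mc≤n′
        (subst (λ d → 2 * m * d < n * q) (∣+m-+n∣≡∣m-n∣ (α * q) (p * n))
          (proj₂ approximation n k (≤-trans (n≤1+n N) N<n) (≤-trans (m≤m+n N T) N+T≤k) (≤-trans (s≤s z≤n) N<n))))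
    where
    α = countA x n
    p = numer a k
    q = denom a k
    p′≡ = proj₁ (convergents-insert c₀ b k)
    q′≡ = proj₂ (convergents-insert c₀ b k)
    r≤c : r ≤ c
    r≤c = ≤-pred (≤-trans r< (length-φL≤ c (x n)))
    e = #A (take r (φL c (x n)))
    e≤r : e ≤ r
    e≤r = ≤-trans (#A≤length (take r (φL c (x n)))) (≤-trans (≤-reflexive (length-take r _)) (m⊓n≤m r _))
    n′≡′ : n′ ≡ n + c * α + r
    n′≡′ = trans n′≡ (cong (_+ r) (φ-start≡ c x n))
    2mc≤n′ : 2 * m * c ≤ n′
    2mc≤n′ = ≤-trans (m≤n+m _ (suc c * suc N)) (≤-trans (m≤n+m T (suc N)) N′≤n′)
    N<n : suc N ≤ n
    N<n with suc N ≤? n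
    ... | yes N<n = N<n
    ... | no  N≮n = ⊥-elim (<⇒≱ (begin-strict
      n′                 ≡⟨ n′≡′ ⟩
      n + c * α + r      <⟨ φ-start-bound c n α r (countA≤ x n) r≤c ⟩
      suc c * suc n      ≤⟨ *-monoʳ-≤ (suc c) (≰⇒> N≮n) ⟩
      suc c * suc N      ≤⟨ m≤m+n _ (2 * m * c) ⟩
      T                  ∎) (≤-trans (m≤n+m T (suc N)) N′≤n′))
      where open ≤-Reasoning
    error≡ : ℤ.∣ ℤ.+ (countA (φ∞ c x) n′ * denom a′ (suc k)) ℤ.- ℤ.+ (numer a′ (suc k) * n′) ∣
             ≡ ∣ (n + c₀ * α + e) * (q + c * p) - (q + c₀ * p) * n′ ∣
    error≡ = trans (∣+m-+n∣≡∣m-n∣ (countA (φ∞ c x) n′ * denom a′ (suc k)) (numer a′ (suc k) * n′))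
               (cong₂ (λ l r → ∣ l - r ∣)
                 (cong₂ _*_ (trans (cong (countA (φ∞ c x)) n′≡) (countA-φ∞ c₀ x n r (<⇒≤ r<))) q′≡)
                 (cong (_* n′) p′≡))

-- Bounds on the slope [0,1,b₂,…]

Recurrence : (ℕ → ℕ) → (ℕ → ℕ) → Set
Recurrence a x = ∀ k → x (suc (suc k)) ≡ a (suc k) * x (suc k) + x k

recurrence-mono : ∀ a {x y} → Recurrence a x → Recurrence a y →
                  ∀ K → y K ≤ x K → y (suc K) ≤ x (suc K) → ∀ d → y (d + K) ≤ x (d + K)
recurrence-mono a {x} {y} rx ry K y≤x₀ y≤x₁ d = proj₁ (two-steps d)
  where
  two-steps : ∀ d → y (d + K) ≤ x (d + K) × y (suc (d + K)) ≤ x (suc (d + K))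
  two-steps zero    = y≤x₀ , y≤x₁
  two-steps (suc d) =
    let i₀ , i₁ = two-steps d in
    i₁ , subst₂ _≤_ (sym (ry (d + K))) (sym (rx (d + K))) (+-mono-≤ (*-monoʳ-≤ (a (suc (d + K))) i₁) i₀)

recurrence-scale : ∀ a x C → Recurrence a x → Recurrence a (λ k → C * x k)
recurrence-scale a x C rx k = trans (cong (C *_) (rx k)) (alg C (a (suc k)) (x (suc k)) (x k))
  where
  alg : ∀ C α y z → C * (α * y + z) ≡ α * (C * y) + C * z
  alg = solve-∀

recurrence-+ : ∀ a x y → Recurrence a x → Recurrence a y → Recurrence a (λ k → x k + y k)
recurrence-+ a x y rx ry k = trans (cong₂ _+_ (rx k) (ry k)) (alg (a (suc k)) (x (suc k)) (x k) (y (suc k)) (y k))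
  where
  alg : ∀ α x₁ x₀ y₁ y₀ → α * x₁ + x₀ + (α * y₁ + y₀) ≡ α * (x₁ + y₁) + (x₀ + y₀)
  alg = solve-∀

module ConvergentBounds (b : ℕ → ℕ) (1≤b : ∀ k → 1 ≤ b k) where
  a = prepend (1 ∷ []) b
  p = numer a
  q = denom a

  rp : Recurrence a p
  rp = numer-recurrence a
  rq : Recurrence a q
  rq = denom-recurrence a

  p₂≡b₀ : p 2 ≡ b 0
  p₂≡b₀ = trans (+-identityʳ (b 0 * 1)) (*-identityʳ (b 0))

  q₂≡p₂+1 : q 2 ≡ p 2 + 1
  q₂≡p₂+1 = cong (_+ 1) (sym (+-identityʳ (b 0 * 1)))

  1≤q₂ : 1 ≤ q 2
  1≤q₂ = subst (1 ≤_) (sym q₂≡p₂+1) (m≤n+m 1 (p 2))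

  q-mono : ∀ k → q (suc k) ≤ q (suc (suc k))
  q-mono k = begin
    q (suc k)                      ≡⟨ *-identityˡ (q (suc k)) ⟨
    1 * q (suc k)                  ≤⟨ *-monoˡ-≤ (q (suc k)) (1≤b k) ⟩
    b k * q (suc k)                ≤⟨ m≤m+n _ (q k) ⟩
    b k * q (suc k) + q k          ≡⟨ rq k ⟨
    q (suc (suc k))                ∎
    where open ≤-Reasoning

  q₂≤2p₂ : q 2 ≤ 2 * p 2
  q₂≤2p₂ = subst₂ _≤_ (sym (trans q₂≡p₂+1 (cong (_+ 1) p₂≡b₀))) (cong (2 *_) (sym p₂≡b₀))
             (+-monoʳ-≤ (b 0) (≤-trans (1≤b 0) (≤-reflexive (sym (+-identityʳ (b 0))))))

  q₃+1≤2p₃ : q 3 + 1 ≤ 2 * p 3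
  q₃+1≤2p₃ = begin
    q 3 + 1                   ≡⟨ cong (_+ 1) (rq 1) ⟩
    b 1 * q 2 + 1 + 1         ≡⟨ +-assoc (b 1 * q 2) 1 1 ⟩
    b 1 * q 2 + 2             ≤⟨ +-monoˡ-≤ 2 (*-monoʳ-≤ (b 1) q₂≤2p₂) ⟩
    b 1 * (2 * p 2) + 2       ≡⟨ alg (b 1) (p 2) ⟩
    2 * (b 1 * p 2 + 1)       ≡⟨ cong (2 *_) (rp 1) ⟨
    2 * p 3                   ∎
    where
    open ≤-Reasoning
    alg : ∀ x y → x * (2 * y) + 2 ≡ 2 * (x * y + 1)
    alg = solve-∀

  q₄+1≤2p₄ : q 4 + 1 ≤ 2 * p 4
  q₄+1≤2p₄ = begin
    q 4 + 1                       ≡⟨ cong (_+ 1) (rq 2) ⟩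
    b 2 * q 3 + q 2 + 1           ≤⟨ +-monoʳ-≤ (b 2 * q 3 + q 2) (1≤b 2) ⟩
    b 2 * q 3 + q 2 + b 2         ≡⟨ alg₁ (b 2) (q 3) (q 2) ⟩
    b 2 * (q 3 + 1) + q 2         ≤⟨ +-mono-≤ (*-monoʳ-≤ (b 2) q₃+1≤2p₃) q₂≤2p₂ ⟩
    b 2 * (2 * p 3) + 2 * p 2     ≡⟨ alg₂ (b 2) (p 3) (p 2) ⟩
    2 * (b 2 * p 3 + p 2)         ≡⟨ cong (2 *_) (rp 2) ⟨
    2 * p 4                       ∎
    where
    open ≤-Reasoning
    alg₁ : ∀ x y z → x * y + z + x ≡ x * (y + 1) + z
    alg₁ = solve-∀
    alg₂ : ∀ x y z → x * (2 * y) + 2 * z ≡ 2 * (x * y + z)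
    alg₂ = solve-∀

  p₃+1≤q₃ : p 3 + 1 ≤ q 3
  p₃+1≤q₃ = begin
    p 3 + 1                   ≡⟨ cong (_+ 1) (rp 1) ⟩
    b 1 * p 2 + 1 + 1         ≤⟨ +-monoˡ-≤ 1 (+-monoʳ-≤ (b 1 * p 2) (1≤b 1)) ⟩
    b 1 * p 2 + b 1 + 1       ≡⟨ alg (b 1) (p 2) ⟩
    b 1 * (p 2 + 1) + 1       ≡⟨ cong (λ z → b 1 * z + 1) q₂≡p₂+1 ⟨
    b 1 * q 2 + 1             ≡⟨ rq 1 ⟨
    q 3                       ∎
    where
    open ≤-Reasoning
    alg : ∀ x y → x * y + x + 1 ≡ x * (y + 1) + 1
    alg = solve-∀

  Q₃ = q 3
  Q₄ = q 4

  convergents-above-half : ∀ d → (1 + Q₄) * q (d + 3) ≤ 2 * Q₄ * p (d + 3)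
  convergents-above-half =
    recurrence-mono a (recurrence-scale a p (2 * Q₄) rp) (recurrence-scale a q (1 + Q₄) rq) 3 base₃ base₄
    where
    open ≤-Reasoning
    base₃ : (1 + Q₄) * q 3 ≤ 2 * Q₄ * p 3
    base₃ = begin
      (1 + Q₄) * q 3       ≡⟨ alg₁ Q₄ (q 3) ⟩
      q 3 + Q₄ * q 3       ≤⟨ +-monoˡ-≤ _ (q-mono 2) ⟩
      Q₄ + Q₄ * q 3        ≡⟨ alg₂ Q₄ (q 3) ⟩
      Q₄ * (q 3 + 1)       ≤⟨ *-monoʳ-≤ Q₄ q₃+1≤2p₃ ⟩
      Q₄ * (2 * p 3)       ≡⟨ alg₃ Q₄ (p 3) ⟩
      2 * Q₄ * p 3         ∎
      where
      alg₁ : ∀ x y → (1 + x) * y ≡ y + x * y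
      alg₁ = solve-∀
      alg₂ : ∀ x y → x + x * y ≡ x * (y + 1)
      alg₂ = solve-∀
      alg₃ : ∀ x y → x * (2 * y) ≡ 2 * x * y
      alg₃ = solve-∀
    base₄ : (1 + Q₄) * q 4 ≤ 2 * Q₄ * p 4
    base₄ = begin
      (1 + Q₄) * Q₄        ≡⟨ alg₁ Q₄ ⟩
      Q₄ * (Q₄ + 1)        ≤⟨ *-monoʳ-≤ Q₄ q₄+1≤2p₄ ⟩
      Q₄ * (2 * p 4)       ≡⟨ alg₂ Q₄ (p 4) ⟩
      2 * Q₄ * p 4         ∎
      where
      alg₁ : ∀ x → (1 + x) * x ≡ x * (x + 1)
      alg₁ = solve-∀
      alg₂ : ∀ x y → x * (2 * y) ≡ 2 * x * y
      alg₂ = solve-∀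

  convergents-below-one : ∀ d → Q₃ * p (d + 2) + q (d + 2) ≤ Q₃ * q (d + 2)
  convergents-below-one =
    recurrence-mono a (recurrence-scale a q Q₃ rq)
      (recurrence-+ a (λ k → Q₃ * p k) q (recurrence-scale a p Q₃ rp) rq) 2 base₂ base₃
    where
    open ≤-Reasoning
    alg : ∀ x y → x * y + x ≡ x * (y + 1)
    alg = solve-∀
    base₂ : Q₃ * p 2 + q 2 ≤ Q₃ * q 2
    base₂ = begin
      Q₃ * p 2 + q 2       ≤⟨ +-monoʳ-≤ (Q₃ * p 2) (q-mono 1) ⟩
      Q₃ * p 2 + Q₃        ≡⟨ alg Q₃ (p 2) ⟩
      Q₃ * (p 2 + 1)       ≡⟨ cong (Q₃ *_) q₂≡p₂+1 ⟨
      Q₃ * q 2             ∎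
    base₃ : Q₃ * p 3 + q 3 ≤ Q₃ * q 3
    base₃ = begin
      Q₃ * p 3 + Q₃        ≡⟨ alg Q₃ (p 3) ⟩
      Q₃ * (p 3 + 1)       ≤⟨ *-monoʳ-≤ Q₃ p₃+1≤q₃ ⟩
      Q₃ * q 3             ∎

approximation⇒n+K≤2a : ∀ Q n a p q K → (1 + Q) * q ≤ 2 * Q * p → 4 * Q * ∣ a * q - p * n ∣ < n * q →
                       2 * Q * K ≤ n → n + K ≤ 2 * a
approximation⇒n+K≤2a Q n a p q K above approx K≤ = <⇒≤ (*-cancelˡ-< (2 * Q) (n + K) (2 * a) (begin-strict
  2 * Q * (n + K)            ≡⟨ *-distribˡ-+ (2 * Q) n K ⟩
  2 * Q * n + 2 * Q * K      ≤⟨ +-monoʳ-≤ (2 * Q * n) K≤ ⟩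
  2 * Q * n + n              <⟨ n-bound ⟩
  4 * Q * a                  ≡⟨ alg Q a ⟩
  2 * Q * (2 * a)            ∎))
  where
  open ≤-Reasoning
  D = ∣ a * q - p * n ∣
  alg : ∀ Q a → 4 * Q * a ≡ 2 * Q * (2 * a)
  alg = solve-∀
  scaled : (2 * n * (1 + Q)) * q < (4 * Q * a + n) * q
  scaled = begin-strict
    (2 * n * (1 + Q)) * q        ≡⟨ alg₁ n Q q ⟩
    2 * n * ((1 + Q) * q)        ≤⟨ *-monoʳ-≤ (2 * n) above ⟩
    2 * n * (2 * Q * p)          ≡⟨ alg₂ n Q p ⟩
    4 * Q * (p * n)              ≤⟨ *-monoʳ-≤ (4 * Q) (subst (p * n ≤_) (cong (a * q +_) (∣-∣-comm (p * n) (a * q))) (m≤n+∣m-n∣ (p * n) (a * q))) ⟩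
    4 * Q * (a * q + D)          ≡⟨ *-distribˡ-+ (4 * Q) (a * q) D ⟩
    4 * Q * (a * q) + 4 * Q * D  <⟨ +-monoʳ-< (4 * Q * (a * q)) approx ⟩
    4 * Q * (a * q) + n * q      ≡⟨ alg₃ Q a q n ⟩
    (4 * Q * a + n) * q          ∎
    where
    alg₁ : ∀ n Q q → (2 * n * (1 + Q)) * q ≡ 2 * n * ((1 + Q) * q)
    alg₁ = solve-∀
    alg₂ : ∀ n Q p → 2 * n * (2 * Q * p) ≡ 4 * Q * (p * n)
    alg₂ = solve-∀
    alg₃ : ∀ Q a q n → 4 * Q * (a * q) + n * q ≡ (4 * Q * a + n) * q
    alg₃ = solve-∀
  n-bound : 2 * Q * n + n < 4 * Q * a
  n-bound = +-cancelˡ-< n _ _ (subst₂ _<_ (alg₄ n Q) (+-comm (4 * Q * a) n) (*-cancelʳ-< q _ _ scaled))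
    where
    alg₄ : ∀ n Q → 2 * n * (1 + Q) ≡ n + (2 * Q * n + n)
    alg₄ = solve-∀

approximation⇒a+K≤n : ∀ Q n a p q K → Q * p + q ≤ Q * q → 2 * Q * ∣ a * q - p * n ∣ < n * q →
                      2 * Q * K ≤ n → a + K ≤ n
approximation⇒a+K≤n Q n a p q K below approx K≤ = <⇒≤ (*-cancelˡ-< (2 * Q) (a + K) n (begin-strict
  2 * Q * (a + K)            ≡⟨ *-distribˡ-+ (2 * Q) a K ⟩
  2 * Q * a + 2 * Q * K      ≤⟨ +-monoʳ-≤ (2 * Q * a) K≤ ⟩
  2 * Q * a + n              <⟨ *-cancelʳ-< q _ _ scaled ⟩
  2 * Q * n                  ∎))
  where
  open ≤-Reasoning
  D = ∣ a * q - p * n ∣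
  scaled : (2 * Q * a + n) * q < (2 * Q * n) * q
  scaled = begin-strict
    (2 * Q * a + n) * q                  ≡⟨ alg₁ Q a n q ⟩
    2 * Q * (a * q) + n * q              ≤⟨ +-monoˡ-≤ (n * q) (*-monoʳ-≤ (2 * Q) (m≤n+∣m-n∣ (a * q) (p * n))) ⟩
    2 * Q * (p * n + D) + n * q          ≡⟨ cong (_+ n * q) (*-distribˡ-+ (2 * Q) (p * n) D) ⟩
    2 * Q * (p * n) + 2 * Q * D + n * q  <⟨ +-monoˡ-< (n * q) (+-monoʳ-< (2 * Q * (p * n)) approx) ⟩
    2 * Q * (p * n) + n * q + n * q      ≡⟨ alg₂ Q p n q ⟩
    2 * n * (Q * p + q)                  ≤⟨ *-monoʳ-≤ (2 * n) below ⟩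
    2 * n * (Q * q)                      ≡⟨ alg₃ n Q q ⟩
    (2 * Q * n) * q                      ∎
    where
    alg₁ : ∀ Q a n q → (2 * Q * a + n) * q ≡ 2 * Q * (a * q) + n * q
    alg₁ = solve-∀
    alg₂ : ∀ Q p n q → 2 * Q * (p * n) + n * q + n * q ≡ 2 * n * (Q * p + q)
    alg₂ = solve-∀
    alg₃ : ∀ n Q q → 2 * n * (Q * q) ≡ (2 * Q * n) * q
    alg₃ = solve-∀

module SlopeBounds (b : ℕ → ℕ) (1≤b : ∀ k → 1 ≤ b k) (u : InfWord) (slope : HasSlope u (prepend (1 ∷ []) b)) where
  open ConvergentBounds b 1≤b

  close-approximation : ∀ M → 1 ≤ M → ∀ d L → ∃[ N ]
    M * ∣ countA u (N + suc L) * q (N + d) - p (N + d) * (N + suc L) ∣ < (N + suc L) * q (N + d)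
  close-approximation M 1≤M d L =
    let N , approx = slope M 1≤M in
    N , subst (λ D → M * D < (N + suc L) * q (N + d))
          (∣+m-+n∣≡∣m-n∣ (countA u (N + suc L) * q (N + d)) (p (N + d) * (N + suc L)))
          (approx (N + suc L) (N + d) (m≤m+n N _) (m≤m+n N d) (≤-trans (s≤s z≤n) (≤-reflexive (sym (+-suc N L)))))

  countA-above-half : ∀ K → ∃[ n ] n + K ≤ 2 * countA u n
  countA-above-half K =
    let N , close = close-approximation (4 * Q₄) 1≤4Q₄ 3 (2 * Q₄ * K) in
    N + suc (2 * Q₄ * K) ,
    approximation⇒n+K≤2a Q₄ _ (countA u (N + suc (2 * Q₄ * K))) _ _ K (convergents-above-half N) close (≤-trans (n≤1+n _) (m≤n+m _ N))
    where
    1≤4Q₄ : 1 ≤ 4 * Q₄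
    1≤4Q₄ = ≤-trans (≤-trans 1≤q₂ (≤-trans (q-mono 1) (q-mono 2))) (m≤m+n Q₄ _)

  countA-below-one : ∀ K → ∃[ n ] countA u n + K ≤ n
  countA-below-one K =
    let N , close = close-approximation (2 * Q₃) 1≤2Q₃ 2 (2 * Q₃ * K) in
    N + suc (2 * Q₃ * K) ,
    approximation⇒a+K≤n Q₃ _ (countA u (N + suc (2 * Q₃ * K))) _ _ K (convergents-below-one N) close (≤-trans (n≤1+n _) (m≤n+m _ N))
    where
    1≤2Q₃ : 1 ≤ 2 * Q₃
    1≤2Q₃ = ≤-trans (≤-trans 1≤q₂ (q-mono 1)) (m≤m+n Q₃ _)

-- The factor BB

two-letter-words : List Word
two-letter-words = (A ∷ A ∷ []) ∷ (A ∷ B ∷ []) ∷ (B ∷ A ∷ []) ∷ (B ∷ B ∷ []) ∷ []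

unique-two-letter-words : Unique two-letter-words
unique-two-letter-words = from-yes (unique? two-letter-words)

≢swap⇒≡ : ∀ a x → (a ≡ swap x → ⊥) → a ≡ x
≢swap⇒≡ A A _ = refl
≢swap⇒≡ B B _ = refl
≢swap⇒≡ A B a≢ = ⊥-elim (a≢ refl)
≢swap⇒≡ B A a≢ = ⊥-elim (a≢ refl)

module BB-Free (u : InfWord) (st : Sturmian u)
               (above-half : ∀ K → ∃[ n ] n + K ≤ 2 * countA u n)
               (below-one  : ∀ K → ∃[ n ] countA u n + K ≤ n) where

  Avoids : Letter → Letter → Set
  Avoids x y = ∀ j → u j ≡ x → u (suc j) ≡ y → ⊥

  constant-after : ∀ {x i} → Avoids x (swap x) → u i ≡ x → ∀ d → u (d + i) ≡ x
  constant-after         avoids ui zero    = ui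
  constant-after {x} {i} avoids ui (suc d) = ≢swap⇒≡ _ x (avoids (d + i) (constant-after avoids ui d))

  ¬avoids-AA : ¬ Avoids A A
  ¬avoids-AA avoids with above-half 2
  ... | n , n+2≤ = <⇒≱ (≤-reflexive (sym (+-suc n 1)))
                        (≤-trans n+2≤ (≤-trans (m≤m+n _ (#A (u n ∷ []))) (alternating n)))
    where
    step : ∀ a n x y → (x ≡ A → y ≡ A → ⊥) → 2 * a + #A (x ∷ []) ≤ n + 1 →
           2 * (a + #A (x ∷ [])) + #A (y ∷ []) ≤ suc n + 1
    step a n A A x≢ _   = ⊥-elim (x≢ refl refl)
    step a n A B _  ≤n₁ = subst₂ _≤_ (alg₁ a) (alg₂ n) (+-monoˡ-≤ 1 ≤n₁)
      where
      alg₁ : ∀ a → 2 * a + 1 + 1 ≡ 2 * (a + 1) + 0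
      alg₁ = solve-∀
      alg₂ : ∀ n → n + 1 + 1 ≡ suc n + 1
      alg₂ = solve-∀
    step a n B y _  ≤n₁ =
      ≤-trans (+-mono-≤ (≤-reflexive (alg₁ a)) (#A≤length (y ∷ []))) (subst (2 * a + 0 + 1 ≤_) (alg₂ n) (+-monoˡ-≤ 1 ≤n₁))
      where
      alg₁ : ∀ a → 2 * (a + 0) ≡ 2 * a + 0
      alg₁ = solve-∀
      alg₂ : ∀ n → n + 1 + 1 ≡ suc n + 1
      alg₂ = solve-∀
    -- without AA, at most every other letter is A
    alternating : ∀ n → 2 * countA u n + #A (u n ∷ []) ≤ n + 1
    alternating zero    = ≤-trans (#A≤length (u 0 ∷ [])) (s≤s z≤n)
    alternating (suc n) = subst (λ a → 2 * a + #A (u (suc n) ∷ []) ≤ suc n + 1) (sym (countA-suc u n))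
                            (step (countA u n) n (u n) (u (suc n)) (avoids n) (alternating n))

  ¬avoids-BA : ∀ {i} → u i ≡ B → ¬ Avoids B A
  ¬avoids-BA {i} ui avoids with above-half (2 * i + 1)
  ... | n , n+K≤ = <⇒≱ (≤-reflexive (+-comm 1 (2 * i)))
                        (≤-trans (m≤n+m (2 * i + 1) n) (≤-trans n+K≤ (*-monoʳ-≤ 2 (bounded n))))
    where
    frozen : ∀ d → countA u (d + i) ≡ countA u i
    frozen zero    = refl
    frozen (suc d) = trans (countA-suc u (d + i))
      (trans (cong (λ a → countA u (d + i) + #A (a ∷ [])) (constant-after avoids ui d)) (trans (+-identityʳ _) (frozen d)))
    bounded : ∀ n → countA u n ≤ i
    bounded n with ≤-total n i
    ... | inj₁ n≤i = ≤-trans (countA≤ u n) n≤i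
    ... | inj₂ i≤n = subst (_≤ i) (sym (trans (cong (countA u) (sym (m∸n+n≡m i≤n))) (frozen (n ∸ i)))) (countA≤ u i)

  some-A : ∀ n → 1 ≤ countA u n → ∃[ j ] u j ≡ A
  some-A (suc n) 1≤ = last-or-earlier (u n) refl
    where
    last-or-earlier : ∀ a → u n ≡ a → ∃[ j ] u j ≡ A
    last-or-earlier A un = n , un
    last-or-earlier B un =
      some-A n (subst (1 ≤_) (trans (countA-suc u n) (trans (cong (λ a → countA u n + #A (a ∷ [])) un) (+-identityʳ _))) 1≤)

  ¬avoids-AB : ¬ Avoids A B
  ¬avoids-AB avoids with above-half 1
  ... | n₀ , n₀+1≤ with some-A n₀ (1≤2a⇒1≤a (countA u n₀) (≤-trans (m≤n+m 1 n₀) n₀+1≤))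
    where
    1≤2a⇒1≤a : ∀ a → 1 ≤ 2 * a → 1 ≤ a
    1≤2a⇒1≤a (suc a) _ = s≤s z≤n
  ... | j , uj with below-one (suc j)
  ... | n , A+K≤n = 1+n≰n (≤-trans (≤-reflexive n+1≡) (≤-trans (+-monoˡ-≤ (suc j) B-count≤) A+K≤n))
    where
    j≤n : j ≤ n
    j≤n = ≤-trans (n≤1+n j) (≤-trans (m≤n+m (suc j) (countA u n)) A+K≤n)
    n+1≡ : suc n ≡ (n ∸ j) + suc j
    n+1≡ = trans (cong suc (sym (m∸n+n≡m j≤n))) (sym (+-suc (n ∸ j) j))
    growing : ∀ d → countA u (d + j) ≡ countA u j + d
    growing zero    = sym (+-identityʳ _)
    growing (suc d) = begin
      countA u (suc d + j)                           ≡⟨ countA-suc u (d + j) ⟩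
      countA u (d + j) + #A (u (d + j) ∷ [])         ≡⟨ cong₂ (λ k a → k + #A (a ∷ [])) (growing d) (constant-after avoids uj d) ⟩
      countA u j + d + 1                             ≡⟨ +-assoc (countA u j) d 1 ⟩
      countA u j + (d + 1)                           ≡⟨ cong (countA u j +_) (+-comm d 1) ⟩
      countA u j + suc d                             ∎
      where open ≡-Reasoning
    B-count≤ : n ∸ j ≤ countA u n
    B-count≤ = subst (n ∸ j ≤_) (sym (trans (cong (countA u) (sym (m∸n+n≡m j≤n))) (growing (n ∸ j)))) (m≤n+m (n ∸ j) (countA u j))

  -- u has only three factors of length two, and AA, AB and BA all occur
  no-BB : ∀ i → u i ≡ B → u (suc i) ≡ B → ⊥
  no-BB i ui ui+1 with st 2
  ... | L , length≡3 , _ , _ , complete = go ((A ∷ A ∷ []) ∈? L) ((A ∷ B ∷ []) ∈? L) ((B ∷ A ∷ []) ∈? L)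
    where
    absent⇒avoids : ∀ {x y} → ¬ ((x ∷ y ∷ []) ∈ L) → Avoids x y
    absent⇒avoids xy∉ j ux uy = xy∉ (subst (_∈ L) (cong₂ (λ a b → a ∷ b ∷ []) ux uy) (complete j))
    go : Dec ((A ∷ A ∷ []) ∈ L) → Dec ((A ∷ B ∷ []) ∈ L) → Dec ((B ∷ A ∷ []) ∈ L) → ⊥
    go (no AA∉) _ _ = ¬avoids-AA (absent⇒avoids AA∉)
    go _ (no AB∉) _ = ¬avoids-AB (absent⇒avoids AB∉)
    go _ _ (no BA∉) = ¬avoids-BA ui (absent⇒avoids BA∉)
    go (yes AA∈) (yes AB∈) (yes BA∈) = <⇒≱ (s≤s (≤-reflexive length≡3)) (Unique⇒length≤ unique-two-letter-words two-letter-words⊆L)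
      where
      two-letter-words⊆L : ∀ {z} → z ∈ two-letter-words → z ∈ L
      two-letter-words⊆L (here refl)                         = AA∈
      two-letter-words⊆L (there (here refl))                 = AB∈
      two-letter-words⊆L (there (there (here refl)))         = BA∈
      two-letter-words⊆L (there (there (there (here refl)))) =
        subst (_∈ L) (cong₂ (λ a b → a ∷ b ∷ []) ui ui+1) (complete i)

-- Powers

_^_ : Word → ℕ → Word
w ^ k = concat (replicate k w)

^-+ : ∀ w m n → w ^ (m + n) ≡ w ^ m ++ w ^ n
^-+ w zero    n = refl
^-+ w (suc m) n = trans (cong (w ++_) (^-+ w m n)) (sym (++-assoc w (w ^ m) (w ^ n)))

length-^ : ∀ w q → length (w ^ q) ≡ q * length w
length-^ w zero    = refl
length-^ w (suc q) = trans (length-++ w) (cong (length w +_) (length-^ w q))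

φ-^ : ∀ c w q → φ c (w ^ q) ≡ φ c w ^ q
φ-^ c w zero    = refl
φ-^ c w (suc q) = trans (φ-++ c w (w ^ q)) (cong (φ c w ++_) (φ-^ c w q))

^-conjugate : ∀ w₁ w₂ q → (w₁ ++ w₂) ^ q ++ w₁ ≡ w₁ ++ (w₂ ++ w₁) ^ q
^-conjugate w₁ w₂ zero    = sym (++-identityʳ w₁)
^-conjugate w₁ w₂ (suc q) = begin
  ((w₁ ++ w₂) ++ (w₁ ++ w₂) ^ q) ++ w₁  ≡⟨ ++-assoc (w₁ ++ w₂) _ w₁ ⟩
  (w₁ ++ w₂) ++ (w₁ ++ w₂) ^ q ++ w₁    ≡⟨ cong ((w₁ ++ w₂) ++_) (^-conjugate w₁ w₂ q) ⟩
  (w₁ ++ w₂) ++ w₁ ++ (w₂ ++ w₁) ^ q    ≡⟨ ++-assoc w₁ w₂ _ ⟩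
  w₁ ++ w₂ ++ w₁ ++ (w₂ ++ w₁) ^ q      ≡⟨ cong (w₁ ++_) (++-assoc w₂ w₁ _) ⟨
  w₁ ++ (w₂ ++ w₁) ++ (w₂ ++ w₁) ^ q    ∎
  where open ≡-Reasoning

++-split : ∀ (a b c d : Word) → a ++ b ≡ c ++ d →
  (∃[ e ] (a ≡ c ++ e × e ++ b ≡ d)) ⊎ (∃[ x ] ∃[ e ] (c ≡ a ++ x ∷ e × b ≡ x ∷ e ++ d))
++-split []      b []      d eq = inj₁ ([] , refl , eq)
++-split []      b (y ∷ c) d eq = inj₂ (y , c , refl , eq)
++-split (x ∷ a) b []      d eq = inj₁ (x ∷ a , refl , eq)
++-split (x ∷ a) b (y ∷ c) d eq with ∷-injective eq
... | refl , eq′ with ++-split a b c d eq′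
...   | inj₁ (e , a≡ , d≡)     = inj₁ (e , cong (x ∷_) a≡ , d≡)
...   | inj₂ (z , e , c≡ , b≡) = inj₂ (z , e , cong (x ∷_) c≡ , b≡)

prefix-of-power : ∀ {w} → 1 ≤ length w → ∀ k v t → v ++ t ≡ w ^ k →
  ∃[ q ] ∃[ w₁ ] ∃[ w₂ ] (w₁ ++ w₂ ≡ w × v ≡ w ^ q ++ w₁ × length w₁ < length w)
prefix-of-power 1≤w zero    []    t eq = 0 , [] , _ , refl , refl , 1≤w
prefix-of-power {w} 1≤w (suc k) v t eq with ++-split v t w (w ^ k) eq
... | inj₁ (e , v≡ , e++t≡) =
  let q , w₁ , w₂ , w≡ , e≡ , w₁< = prefix-of-power 1≤w k e t e++t≡ in
  suc q , w₁ , w₂ , w≡ , trans v≡ (trans (cong (w ++_) e≡) (sym (++-assoc w (w ^ q) w₁))) , w₁<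
... | inj₂ (x , e , w≡ , _) =
  0 , v , x ∷ e , sym w≡ , refl ,
  subst (length v <_) (cong length (sym w≡)) (subst (length v <_) (sym (length-++ v)) (m<m+n (length v) (s≤s z≤n)))

BBFree : Word → Set
BBFree z = ∀ p s → z ≡ p ++ B ∷ B ∷ s → ⊥

BBFree-infix : ∀ a z b → BBFree (a ++ z ++ b) → BBFree z
BBFree-infix a z b free p s refl = free (a ++ p) (s ++ b)
  (trans (cong (a ++_) (++-assoc p (B ∷ B ∷ s) b)) (sym (++-assoc a p (B ∷ B ∷ s ++ b))))

factor⇒BBFree : ∀ {x} → (∀ i → x i ≡ B → x (suc i) ≡ B → ⊥) → ∀ z → Factor z x → BBFree z
factor⇒BBFree {x} no-BB z f p s refl with factor-prefix (B ∷ B ∷ []) s (factor-suffix p (B ∷ B ∷ s) f)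
... | j , xj∷xj+1≡BB = let xj , rest = ∷-injective xj∷xj+1≡BB in no-BB j xj (proj₁ (∷-injective rest))

φ-BBFree : ∀ c x y z → BBFree (x ∷ y ∷ z) → ∃[ r ] φ c (x ∷ y ∷ z) ≡ replicate c A ++ r
φ-BBFree c A y z _    = B ∷ φ c (y ∷ z) , ++-assoc (replicate c A) (B ∷ []) (φ c (y ∷ z))
φ-BBFree c B A z _    = A ∷ B ∷ φ c z , trans (cong (A ∷_) (++-assoc (replicate c A) (B ∷ []) (φ c z)))
                                               (sym (replicate-++-∷ c A (B ∷ φ c z)))
φ-BBFree c B B z free = ⊥-elim (free [] z refl)

φ∞-factor : ∀ c {x} → (∀ i → x i ≡ B → x (suc i) ≡ B → ⊥) → ∀ v → Factor v x →
            Factor (φ c v ++ replicate c A) (φ∞ c x)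
φ∞-factor c {x} no-BB v (i , occ) =
  factor-prefix (φ c v ++ replicate c A) r (factor-subst φ≡ (factor-φ∞ c _ f))
  where
  a₁ = x (i + length v)
  a₂ = x (suc (i + length v))
  f : Factor (v ++ a₁ ∷ a₂ ∷ []) x
  f = slice⇒factor i (length v + 2) (trans (slice-+ x i (length v) 2) (cong (_++ a₁ ∷ a₂ ∷ []) occ))
  head = φ-BBFree c a₁ a₂ [] (factor⇒BBFree no-BB _ (factor-suffix v (a₁ ∷ a₂ ∷ []) f))
  r = proj₁ head
  φ≡ : φ c (v ++ a₁ ∷ a₂ ∷ []) ≡ (φ c v ++ replicate c A) ++ r
  φ≡ = trans (φ-++ c v (a₁ ∷ a₂ ∷ [])) (trans (cong (φ c v ++_) (proj₂ head)) (sym (++-assoc (φ c v) (replicate c A) r)))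

doubled-two-letters : ∀ (V : Word) → 1 ≤ length V → ∃[ x ] ∃[ y ] ∃[ z ] V ++ V ≡ x ∷ y ∷ z
doubled-two-letters (x ∷ [])     _ = x , x , [] , refl
doubled-two-letters (x ∷ y ∷ V′) _ = x , y , V′ ++ x ∷ y ∷ V′ , refl

length≤length-φ : ∀ c w → length w ≤ length (φ c w)
length≤length-φ c w = subst (length w ≤_) (sym (length-φ c w)) (m≤m+n (length w) _)

φ-power-periodic : ∀ c w₁ w₂ q → 1 ≤ length (w₁ ++ w₂) → BBFree ((w₁ ++ w₂) ^ (2 + q) ++ w₁) →
  IsPower (φ c ((w₁ ++ w₂) ^ (2 + q) ++ w₁) ++ replicate c A) (φ c (w₁ ++ w₂))
φ-power-periodic c w₁ w₂ q 1≤W free = 1≤φW , φW≤ , 2 + q + 3 , r ++ φ c w₂ , φ-equation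
  where
  W = w₁ ++ w₂
  V = w₂ ++ w₁
  v = W ^ (2 + q) ++ w₁
  v≡ : v ≡ w₁ ++ (V ++ V) ++ V ^ q
  v≡ = trans (^-conjugate w₁ w₂ (2 + q)) (cong (w₁ ++_) (sym (++-assoc V V (V ^ q))))
  continuation : v ++ (V ++ V) ++ w₂ ≡ W ^ (2 + q + 3)
  continuation = begin
    (W ^ (2 + q) ++ w₁) ++ (V ++ V) ++ w₂     ≡⟨ ++-assoc (W ^ (2 + q)) w₁ _ ⟩
    W ^ (2 + q) ++ w₁ ++ (V ++ V) ++ w₂       ≡⟨ cong (W ^ (2 + q) ++_) rotate ⟩
    W ^ (2 + q) ++ W ^ 3                      ≡⟨ ^-+ W (2 + q) 3 ⟨
    W ^ (2 + q + 3)                           ∎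
    where
    open ≡-Reasoning
    rotate : w₁ ++ (V ++ V) ++ w₂ ≡ W ^ 3
    rotate = begin
      w₁ ++ (V ++ V) ++ w₂                    ≡⟨ cong (w₁ ++_) (++-assoc V V w₂) ⟩
      w₁ ++ V ++ V ++ w₂                      ≡⟨ cong (w₁ ++_) (++-assoc w₂ w₁ _) ⟩
      w₁ ++ w₂ ++ w₁ ++ V ++ w₂               ≡⟨ ++-assoc w₁ w₂ _ ⟨
      W ++ w₁ ++ V ++ w₂                      ≡⟨ cong (λ z → W ++ w₁ ++ z) (++-assoc w₂ w₁ w₂) ⟩
      W ++ w₁ ++ w₂ ++ w₁ ++ w₂               ≡⟨ cong (W ++_) (++-assoc w₁ w₂ _) ⟨
      W ++ W ++ w₁ ++ w₂                      ≡⟨ cong (λ z → W ++ W ++ z) (++-identityʳ W) ⟨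
      W ^ 3                                   ∎
  1≤V : 1 ≤ length V
  1≤V = subst (1 ≤_) (trans (length-++ w₁) (trans (+-comm (length w₁) (length w₂)) (sym (length-++ w₂)))) 1≤W
  two = doubled-two-letters V 1≤V
  x = proj₁ two
  y = proj₁ (proj₂ two)
  z = proj₁ (proj₂ (proj₂ two))
  VV≡ = proj₂ (proj₂ (proj₂ two))
  head = φ-BBFree c x y z (subst BBFree VV≡ (BBFree-infix w₁ (V ++ V) (V ^ q) (subst BBFree v≡ free)))
  r = proj₁ head
  φVV≡ : φ c (V ++ V) ≡ replicate c A ++ r
  φVV≡ = trans (cong (φ c) VV≡) (proj₂ head)
  φ-equation : (φ c v ++ replicate c A) ++ r ++ φ c w₂ ≡ φ c W ^ (2 + q + 3)
  φ-equation = begin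
    (φ c v ++ replicate c A) ++ r ++ φ c w₂   ≡⟨ ++-assoc (φ c v) (replicate c A) _ ⟩
    φ c v ++ replicate c A ++ r ++ φ c w₂     ≡⟨ cong (φ c v ++_) (++-assoc (replicate c A) r (φ c w₂)) ⟨
    φ c v ++ (replicate c A ++ r) ++ φ c w₂   ≡⟨ cong (λ u → φ c v ++ u ++ φ c w₂) φVV≡ ⟨
    φ c v ++ φ c (V ++ V) ++ φ c w₂           ≡⟨ cong (φ c v ++_) (φ-++ c (V ++ V) w₂) ⟨
    φ c v ++ φ c ((V ++ V) ++ w₂)             ≡⟨ φ-++ c v _ ⟨
    φ c (v ++ (V ++ V) ++ w₂)                 ≡⟨ cong (φ c) continuation ⟩
    φ c (W ^ (2 + q + 3))                     ≡⟨ φ-^ c W (2 + q + 3) ⟩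
    φ c W ^ (2 + q + 3)                       ∎
    where open ≡-Reasoning
  1≤φW : 1 ≤ length (φ c W)
  1≤φW = ≤-trans 1≤W (length≤length-φ c W)
  φW≤ : length (φ c W) ≤ length (φ c v ++ replicate c A)
  φW≤ = begin
    length (φ c W)                                    ≤⟨ m≤m+n _ _ ⟩
    length (φ c W) + length (φ c (W ^ (1 + q) ++ w₁)) ≡⟨ length-++ (φ c W) ⟨
    length (φ c W ++ φ c (W ^ (1 + q) ++ w₁))         ≡⟨ cong length (φ-++ c W _) ⟨
    length (φ c (W ++ W ^ (1 + q) ++ w₁))             ≡⟨ cong (λ u → length (φ c u)) (++-assoc W (W ^ (1 + q)) w₁) ⟨
    length (φ c v)                                    ≤⟨ m≤m+n _ _ ⟩
    length (φ c v) + length (replicate c A)           ≡⟨ length-++ (φ c v) ⟨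
    length (φ c v ++ replicate c A)                   ∎
    where open ≤-Reasoning

length-^-++< : ∀ w q {w₁} → length w₁ < length w → length (w ^ q ++ w₁) < suc q * length w
length-^-++< w q {w₁} w₁< = begin-strict
  length (w ^ q ++ w₁)          ≡⟨ length-++ (w ^ q) ⟩
  length (w ^ q) + length w₁    <⟨ +-monoʳ-< (length (w ^ q)) w₁< ⟩
  length (w ^ q) + length w     ≡⟨ cong (_+ length w) (length-^ w q) ⟩
  q * length w + length w       ≡⟨ +-comm (q * length w) (length w) ⟩
  suc q * length w              ∎
  where open ≤-Reasoning

φ-power : ∀ c {v w} → IsPower v w → 2 * length w ≤ length v → BBFree v →
          IsPower (φ c v ++ replicate c A) (φ c w)
φ-power c {v} {w} (1≤w , _ , k , t , eq) 2w≤v free with prefix-of-power 1≤w k v t eq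
... | zero , w₁ , w₂ , refl , refl , w₁<w =
  ⊥-elim (<⇒≱ (≤-trans (length-^-++< (w₁ ++ w₂) 0 {w₁} w₁<w) (*-monoˡ-≤ (length (w₁ ++ w₂)) (n≤1+n 1))) 2w≤v)
... | suc zero , w₁ , w₂ , refl , refl , w₁<w =
  ⊥-elim (<⇒≱ (length-^-++< (w₁ ++ w₂) 1 {w₁} w₁<w) 2w≤v)
... | suc (suc q) , w₁ , w₂ , refl , refl , _ = φ-power-periodic c w₁ w₂ q 1≤w free

lemma8 : (c : ℕ) → 1 ≤ c → (b : ℕ → ℕ) → (∀ k → 1 ≤ b k) →
    (u : InfWord) → Sturmian u → HasSlope u (prepend (1 ∷ []) b) →
    (w v : Word) → Factor w u → Factor v u →
    IsPower v w → 2 * length w ≤ length v →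
    IsPower (φ c v ++ replicate c A) (φ c w)
    × (∃[ u′ ] (Sturmian u′ × HasSlope u′ (prepend (1 ∷ c ∷ []) b)
               × Factor (φ c v ++ replicate c A) u′))
lemma8 (suc c₀) (s≤s z≤n) b 1≤b u sturmian slope w v _ v-factor v≡w^r 2w≤v =
  φ-power c v≡w^r 2w≤v (factor⇒BBFree no-BB v v-factor) ,
  φ∞ c u , Sturmian-φ∞ c sturmian , HasSlope-φ∞ c₀ b u slope , φ∞-factor c no-BB v v-factor
  where
  c = suc c₀
  open SlopeBounds b 1≤b u slope
  no-BB = BB-Free.no-BB u sturmian countA-above-half countA-below-one
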